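{- Let $g\ge 2$ and let $H\subset\mathrm{GSp}_{2g}(\mathbb Z_2)$ be a subgroup with $H=\pi_{2^\infty\to2}^{ -1}(H(2))$ and $H(2)\supset S_{2g+1}$. Then $\ker\varphi_{2^\infty\to4}\subset[H,H]$.
   Context: $\pi_{2^\infty\to2}:\mathrm{GSp}_{2g}(\mathbb Z_2)\to\mathrm{GSp}_{2g}(\mathbb Z/2\mathbb Z)$ and $\varphi_{2^\infty\to4}:\mathrm{Sp}_{2g}(\mathbb Z_2)\to\mathrm{Sp}_{2g}(\mathbb Z/4\mathbb Z)$ are reduction maps; $H(2)$ is the mod-2 image of $H$; $[H,H]$ is the closure of the commutator subgroup. The embedding $S_{2g+1}\subset S_{2g+2}\subset\mathrm{Sp}_{2g}(\mathbb Z/2\mathbb Z)$ comes from the permutation action of $S_{2g+2}$ on $W=t^\perp/\mathrm{span}(t)$, $t=(1,\dots,1)\in\mathbb F_2^{2g+2}$ with the form induced by the standard dot product; $S_{2g+1}$ fixes the last coordinate. -}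

module Defs where

open import Data.Nat as ℕ using (ℕ; zero; suc; _≤_)
open import Data.Integer as ℤ using (ℤ; +_)
open import Data.Integer.Divisibility using (_∣_)
open import Data.Bool using (Bool; true; false; if_then_else_; _∧_; _xor_)
open import Data.Fin using (Fin; zero; suc; toℕ; fromℕ)
open import Data.Fin.Permutation using (Permutation′; _⟨$⟩ʳ_; _⟨$⟩ˡ_)
open import Data.Product using (Σ; _×_)
open import Relation.Binary.PropositionalEquality using (_≡_)
open import Relation.Nullary using (¬_)
open import Relation.Nullary.Decidable using (⌊_⌋)

-- A raw element is a sequence x : ℕ → ℤ; x n represents the residue mod 2^n.
-- A genuine element of ℤ₂ is a *coherent* sequence:
--   x (n+1) ≡ x n  (mod 2^n).
-- Two elements agree mod 2^k iff 2^k ∣ x k - y k; they are equal iff this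
-- holds for all k.

Z2 : Set
Z2 = ℕ → ℤ

Coherent : Z2 → Set
Coherent x = ∀ n → (+ (2 ℕ.^ n)) ∣ (x (suc n) ℤ.- x n)

ModEq : ℕ → Z2 → Z2 → Set
ModEq k x y = (+ (2 ℕ.^ k)) ∣ (x k ℤ.- y k)

IsUnit : Z2 → Set
IsUnit x = ¬ ((+ 2) ∣ x 1)

Mat : ℕ → Set
Mat m = Fin m → Fin m → Z2

sumℤ : ∀ {m} → (Fin m → ℤ) → ℤ
sumℤ {zero}  f = + 0
sumℤ {suc m} f = f zero ℤ.+ sumℤ (λ i → f (suc i))

_⊗_ : ∀ {m} → Mat m → Mat m → Mat m
(A ⊗ B) i j n = sumℤ (λ l → A i l n ℤ.* B l j n)

transpose : ∀ {m} → Mat m → Mat m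
transpose A i j = A j i

idM : ∀ {m} → Mat m
idM i j n = if ⌊ i Data.Fin.≟ j ⌋ then + 1 else + 0

scal : ∀ {m} → Z2 → Mat m → Mat m
scal c A i j n = c n ℤ.* A i j n

-- standard symplectic matrix J = [[0, I_g], [-I_g, 0]] of size 2g
J : (g : ℕ) → Mat (2 ℕ.* g)
J g i j n =
  if toℕ j ℕ.≡ᵇ (toℕ i ℕ.+ g) then + 1
  else if toℕ i ℕ.≡ᵇ (toℕ j ℕ.+ g) then ℤ.- (+ 1)
  else + 0

CongMat : ∀ {m} → ℕ → Mat m → Mat m → Set
CongMat k A B = ∀ i j → ModEq k (A i j) (B i j)

EqMat : ∀ {m} → Mat m → Mat m → Set
EqMat A B = ∀ k → CongMat k A B

CoherentMat : ∀ {m} → Mat m → Set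
CoherentMat A = ∀ i j → Coherent (A i j)

IsGSp : (g : ℕ) → Mat (2 ℕ.* g) → Set
IsGSp g A = CoherentMat A ×
  Σ Z2 (λ c → Coherent c × IsUnit c ×
    EqMat (transpose A ⊗ (J g ⊗ A)) (scal c (J g)))

IsSp : (g : ℕ) → Mat (2 ℕ.* g) → Set
IsSp g A = CoherentMat A × EqMat (transpose A ⊗ (J g ⊗ A)) (J g)

record IsSubgroupGSp (g : ℕ) (H : Mat (2 ℕ.* g) → Set) : Set where
  field
    ⊆GSp : ∀ A → H A → IsGSp g A
    id∈  : H idM
    mul∈ : ∀ A B → H A → H B → H (A ⊗ B)
    inv∈ : ∀ A → H A → Σ (Mat (2 ℕ.* g)) (λ B → H B × EqMat (A ⊗ B) idM × EqMat (B ⊗ A) idM)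

-- H = π_{2^∞→2}^{-1}(H(2)) : every element of GSp_{2g}(ℤ₂) congruent mod 2
-- to an element of H lies in H.
FullPreimage : (g : ℕ) → (Mat (2 ℕ.* g) → Set) → Set
FullPreimage g H = ∀ A B → H A → IsGSp g B → CongMat 1 A B → H B

-- 𝔽₂-linear algebra (𝔽₂ = Bool with xor, ∧)

red2 : ℤ → Bool
red2 x = (ℤ.∣ x ∣ ℕ.% 2) ℕ.≡ᵇ 1

reduce : ∀ {m} → Mat m → Fin m → Fin m → Bool
reduce A i j = red2 (A i j 1)

xorSum : ∀ {m} → (Fin m → Bool) → Bool
xorSum {zero}  f = false
xorSum {suc m} f = f zero xor xorSum (λ i → f (suc i))

mulV : ∀ {m} → (Fin m → Fin m → Bool) → (Fin m → Bool) → Fin m → Bool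
mulV M v i = xorSum (λ j → M i j ∧ v j)

dot : ∀ {N} → (Fin N → Bool) → (Fin N → Bool) → Bool
dot v w = xorSum (λ i → v i ∧ w i)

ω : (g : ℕ) → (Fin (2 ℕ.* g) → Bool) → (Fin (2 ℕ.* g) → Bool) → Bool
ω g x y = xorSum (λ i → xorSum (λ j → x i ∧ (reduce (J g) i j ∧ y j)))

-- ambient space 𝔽₂^{2g+2}, indexed by Fin (suc (2g+1)); last index = fromℕ (2g+1)
Big : ℕ → Set
Big g = Fin (suc (2 ℕ.* g ℕ.+ 1)) → Bool

tvec : (g : ℕ) → Big g
tvec g i = true

InTPerp : (g : ℕ) → Big g → Set
InTPerp g v = dot (tvec g) v ≡ false

_⊕_ : ∀ {N} → (Fin N → Bool) → (Fin N → Bool) → Fin N → Bool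
(v ⊕ w) i = v i xor w i

-- φ : t^⊥ → 𝔽₂^{2g} inducing a symplectic isomorphism W = t^⊥/span(t) ≅ (𝔽₂^{2g}, ω)
record SymplecticIdentification (g : ℕ) (φ : Big g → Fin (2 ℕ.* g) → Bool) : Set where
  field
    linear    : ∀ v w → InTPerp g v → InTPerp g w → ∀ i → φ (v ⊕ w) i ≡ (φ v ⊕ φ w) i
    kills-t   : ∀ i → φ (tvec g) i ≡ false
    surj      : ∀ (x : Fin (2 ℕ.* g) → Bool) → Σ (Big g) (λ v → InTPerp g v × (∀ i → φ v i ≡ x i))
    isometric : ∀ v w → InTPerp g v → InTPerp g w → ω g (φ v) (φ w) ≡ dot v w

-- permutation action of S_{2g+2} on 𝔽₂^{2g+2}: (σ·v)_{σ(i)} = v_i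
permV : (g : ℕ) → Permutation′ (suc (2 ℕ.* g ℕ.+ 1)) → Big g → Big g
permV g σ v i = v (σ ⟨$⟩ˡ i)

-- H(2) ⊇ S_{2g+1}, where S_{2g+1} ⊂ S_{2g+2} ⊂ Sp_{2g}(𝔽₂) via the action on W
ContainsS : (g : ℕ) → (Mat (2 ℕ.* g) → Set) → Set
ContainsS g H =
  Σ (Big g → Fin (2 ℕ.* g) → Bool) (λ φ → SymplecticIdentification g φ ×
    (∀ (σ : Permutation′ (suc (2 ℕ.* g ℕ.+ 1))) →
       σ ⟨$⟩ʳ fromℕ (2 ℕ.* g ℕ.+ 1) ≡ fromℕ (2 ℕ.* g ℕ.+ 1) →
       Σ (Mat (2 ℕ.* g)) (λ A → H A ×
         (∀ v → InTPerp g v → ∀ i → mulV (reduce A) (φ v) i ≡ φ (permV g σ v) i))))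

data CommSub {m} (H : Mat m → Set) : Mat m → Set where
  c-id   : CommSub H idM
  c-step : ∀ {C a a' b b'} → CommSub H C → H a → H a' → H b → H b' →
           EqMat (a ⊗ a') idM → EqMat (b ⊗ b') idM →
           CommSub H (C ⊗ (a ⊗ (b ⊗ (a' ⊗ b'))))

-- M lies in the (2-adic) closure [H,H] of the commutator subgroup
InClosureComm : ∀ {m} → (Mat m → Set) → Mat m → Set
InClosureComm H M = ∀ k → Σ (Mat _) (λ C → CommSub H C × CongMat k C M)

module Submission where

-- Being a full preimage, H contains every 2-adic similitude ≡ I (mod 2); nothing else about H is
-- used.  Such elements are the
-- transvections I + 2y·E along root elements E of sp_{2g}, ±1 diagonal matrices, and the
-- similitude diag(I, −I).  Their commutators are ≡ I + 2ⁿ X (mod 2ⁿ⁺¹) for every n ≥ 2 and every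
-- root or Cartan direction X (`long-move`, `short-move`, `cartan-move`).  Working modulo 2ᵏ we
-- keep M ≡ R N with R a product of commutators and N symplectic, N ≡ I (mod 2ⁿ).  The first-order
-- term U of N ≡ I + 2ⁿ U is Hamiltonian mod 2 (`expansion-symmetric`), so multiplying N by inverse
-- commutators entry by entry (`sweep`) makes U even, i.e. N ≡ I (mod 2ⁿ⁺¹) (`level-step`).
-- Climbing from n = 2 to n = k gives M ≡ R (mod 2ᵏ) for every k.

open import Defs

module Development where

  open import Data.Nat as ℕ using (ℕ; zero; suc; _<_; _≤_; _∸_; _≡ᵇ_)
  import Data.Nat.Properties as ℕP
  import Data.Nat.Divisibility as ℕD
  open import Data.Integer as ℤ using (ℤ; +_; _+_; _*_; -_; _-_)
  import Data.Integer.Properties as ℤP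
  open import Data.Integer.Divisibility.Signed
    using (_∣_; divides; ∣⇒∣ᵤ; ∣ᵤ⇒∣; ∣-trans; ∣m∣n⇒∣m+n; ∣m∣n⇒∣m-n; ∣m+n∣n⇒∣m; ∣m⇒∣-m; ∣n⇒∣m*n; ∣m⇒∣m*n; *-cancelˡ-∣)
  open import Data.Integer.Tactic.RingSolver using (solve-∀)
  open import Data.Fin using (Fin; zero; suc; toℕ; fromℕ<)
  import Data.Fin.Properties as FP
  open FP using (_≟_)
  open import Data.Bool using (true; false; if_then_else_)
  open import Data.Product using (Σ; _×_; _,_; proj₁; proj₂)
  open import Data.Sum using (_⊎_; inj₁; inj₂)
  open import Data.List using (List; []; _∷_; allFin; cartesianProduct)
  open import Data.List.Relation.Unary.Any using (here; there)
  open import Data.List.Membership.Propositional using (_∈_)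
  open import Data.List.Membership.Propositional.Properties using (∈-allFin; ∈-cartesianProduct⁺)
  open import Relation.Nullary using (Dec; yes; no; ¬_; contradiction)
  open import Relation.Nullary.Decidable using (⌊_⌋; _×-dec_)
  open import Relation.Binary.PropositionalEquality hiding (J)
  open import Relation.Binary.Bundles using (Setoid)
  import Relation.Binary.Reasoning.Setoid as SetoidReasoning
  open import Level using (0ℓ)

  δ : ∀ {m} → Fin m → Fin m → ℤ
  δ a b = if ⌊ a ≟ b ⌋ then + 1 else + 0

  δ-diag : ∀ {m} (a : Fin m) → δ a a ≡ + 1
  δ-diag a with a ≟ a
  ... | yes _ = refl
  ... | no a≢a = contradiction refl a≢a

  δ-off : ∀ {m} {a b : Fin m} → ¬ a ≡ b → δ a b ≡ + 0
  δ-off {a = a} {b} a≢b with a ≟ b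
  ... | yes a≡b = contradiction a≡b a≢b
  ... | no _ = refl

  δ-sym : ∀ {m} (a b : Fin m) → δ a b ≡ δ b a
  δ-sym a b with a ≟ b
  ... | yes refl = sym (δ-diag a)
  ... | no a≢b = sym (δ-off (λ b≡a → a≢b (sym b≡a)))

  δ-suc : ∀ {m} (a b : Fin m) → δ (suc a) (suc b) ≡ δ a b
  δ-suc a b with a ≟ b
  ... | yes refl = refl
  ... | no a≢b = refl

  δ-subst : ∀ {m} (a b : Fin m) (f : Fin m → ℤ) → δ a b * f a ≡ δ a b * f b
  δ-subst a b f with a ≟ b
  ... | yes refl = refl
  ... | no _ = refl

  δδ-subst : ∀ {m} (a u b v : Fin m) (F : Fin m → Fin m → ℤ) →
    δ a u * δ b v * F a b ≡ δ a u * δ b v * F u v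
  δδ-subst a u b v F with a ≟ u | b ≟ v
  ... | yes refl | yes refl = refl
  ... | yes refl | no _ = trans (ℤP.*-zeroˡ (F a b)) (sym (ℤP.*-zeroˡ (F a v)))
  ... | no _ | _ = refl

  telescope : ∀ u v w → u - v + (v - w) ≡ u - w
  telescope = solve-∀

  sum-cong : ∀ {m} {f h : Fin m → ℤ} → (∀ l → f l ≡ h l) → sumℤ f ≡ sumℤ h
  sum-cong {zero} e = refl
  sum-cong {suc m} e = cong₂ _+_ (e zero) (sum-cong (λ l → e (suc l)))

  sum-+ : ∀ {m} (f h : Fin m → ℤ) → sumℤ (λ l → f l + h l) ≡ sumℤ f + sumℤ h
  sum-+ {zero} f h = refl
  sum-+ {suc m} f h = trans (cong (_+_ (f zero + h zero)) (sum-+ (λ l → f (suc l)) (λ l → h (suc l))))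
    (interchange (f zero) (h zero) _ _)
    where
    interchange : ∀ a b c d → (a + b) + (c + d) ≡ (a + c) + (b + d)
    interchange = solve-∀

  sum-*ˡ : ∀ {m} c (f : Fin m → ℤ) → sumℤ (λ l → c * f l) ≡ c * sumℤ f
  sum-*ˡ {zero} c f = sym (ℤP.*-zeroʳ c)
  sum-*ˡ {suc m} c f = trans (cong (_+_ (c * f zero)) (sum-*ˡ c (λ l → f (suc l))))
    (sym (ℤP.*-distribˡ-+ c (f zero) _))

  sum-*ʳ : ∀ {m} c (f : Fin m → ℤ) → sumℤ f * c ≡ sumℤ (λ l → f l * c)
  sum-*ʳ c f = trans (ℤP.*-comm (sumℤ f) c) (trans (sym (sum-*ˡ c f)) (sum-cong (λ l → ℤP.*-comm c (f l))))

  sum-zero : ∀ {m} → sumℤ {m} (λ _ → + 0) ≡ + 0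
  sum-zero {zero} = refl
  sum-zero {suc m} = trans (ℤP.+-identityˡ _) (sum-zero {m})

  sum-δ : ∀ {m} (c : Fin m) (f : Fin m → ℤ) → sumℤ (λ l → δ c l * f l) ≡ f c
  sum-δ {suc m} zero f = begin
    + 1 * f zero + sumℤ (λ l → + 0 * f (suc l)) ≡⟨ cong₂ _+_ (ℤP.*-identityˡ (f zero)) (sum-cong (λ l → ℤP.*-zeroˡ (f (suc l)))) ⟩
    f zero + sumℤ {m} (λ _ → + 0)              ≡⟨ cong (_+_ (f zero)) (sum-zero {m}) ⟩
    f zero + + 0                               ≡⟨ ℤP.+-identityʳ (f zero) ⟩
    f zero                                     ∎
    where open ≡-Reasoning
  sum-δ {suc m} (suc c) f = begin
    + 0 * f zero + sumℤ (λ l → δ (suc c) (suc l) * f (suc l)) ≡⟨ cong₂ _+_ (ℤP.*-zeroˡ (f zero)) (sum-cong (λ l → cong (_* f (suc l)) (δ-suc c l))) ⟩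
    + 0 + sumℤ (λ l → δ c l * f (suc l))                     ≡⟨ ℤP.+-identityˡ _ ⟩
    sumℤ (λ l → δ c l * f (suc l))                           ≡⟨ sum-δ c (λ l → f (suc l)) ⟩
    f (suc c)                                                ∎
    where open ≡-Reasoning

  sum-δʳ : ∀ {m} (c : Fin m) (f : Fin m → ℤ) → sumℤ (λ l → f l * δ l c) ≡ f c
  sum-δʳ c f = trans (sum-cong (λ l → trans (ℤP.*-comm (f l) (δ l c)) (cong (_* f l) (δ-sym l c))))
    (sum-δ c f)

  sum-swap : ∀ {m n} (F : Fin m → Fin n → ℤ) →
    sumℤ (λ l → sumℤ (λ k → F l k)) ≡ sumℤ (λ k → sumℤ (λ l → F l k))
  sum-swap {zero} {n} F = sym (sum-zero {n})
  sum-swap {suc m} F = trans (cong (_+_ (sumℤ (F zero))) (sum-swap (λ l → F (suc l))))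
    (sym (sum-+ (F zero) (λ k → sumℤ (λ l → F (suc l) k))))

  sum-- : ∀ {m} (f h : Fin m → ℤ) → sumℤ (λ l → f l - h l) ≡ sumℤ f - sumℤ h
  sum-- {zero} f h = refl
  sum-- {suc m} f h = trans (cong (_+_ (f zero - h zero)) (sum-- (λ l → f (suc l)) (λ l → h (suc l))))
    (interchange (f zero) (h zero) _ _)
    where
    interchange : ∀ a b c d → (a - b) + (c - d) ≡ (a + c) - (b + d)
    interchange = solve-∀

  sum-∣ : ∀ {m q} (f : Fin m → ℤ) → (∀ l → q ∣ f l) → q ∣ sumℤ f
  sum-∣ {zero} f d = divides (+ 0) refl
  sum-∣ {suc m} f d = ∣m∣n⇒∣m+n (d zero) (sum-∣ (λ l → f (suc l)) (λ l → d (suc l)))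

  -- Square integer matrices (one 2-adic level of a `Mat`), with product and transpose.
  IM : ℕ → Set
  IM m = Fin m → Fin m → ℤ

  infix 4 _≈_
  _≈_ : ∀ {m} → IM m → IM m → Set
  A ≈ B = ∀ i j → A i j ≡ B i j

  infixl 7 _∙_
  _∙_ : ∀ {m} → IM m → IM m → IM m
  (A ∙ B) i j = sumℤ (λ l → A i l * B l j)

  _ᵀ : ∀ {m} → IM m → IM m
  (A ᵀ) i j = A j i

  ≈-refl : ∀ {m} {A : IM m} → A ≈ A
  ≈-refl _ _ = refl

  ≈-sym : ∀ {m} {A B : IM m} → A ≈ B → B ≈ A
  ≈-sym e i j = sym (e i j)

  ≈-trans : ∀ {m} {A B C : IM m} → A ≈ B → B ≈ C → A ≈ C
  ≈-trans e f i j = trans (e i j) (f i j)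

  ≈-setoid : ℕ → Setoid 0ℓ 0ℓ
  ≈-setoid m = record
    { Carrier = IM m
    ; _≈_ = _≈_
    ; isEquivalence = record { refl = ≈-refl ; sym = ≈-sym ; trans = ≈-trans } }

  module ≈-Reasoning {m : ℕ} = SetoidReasoning (≈-setoid m)

  ∙-cong : ∀ {m} {A A′ B B′ : IM m} → A ≈ A′ → B ≈ B′ → A ∙ B ≈ A′ ∙ B′
  ∙-cong e f i j = sum-cong (λ l → cong₂ _*_ (e i l) (f l j))

  ∙-assoc : ∀ {m} (A B C : IM m) → (A ∙ B) ∙ C ≈ A ∙ (B ∙ C)
  ∙-assoc A B C i j = begin
    sumℤ (λ k → sumℤ (λ l → A i l * B l k) * C k j)     ≡⟨ sum-cong (λ k → sum-*ʳ (C k j) (λ l → A i l * B l k)) ⟩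
    sumℤ (λ k → sumℤ (λ l → A i l * B l k * C k j))     ≡⟨ sum-cong (λ k → sum-cong (λ l → ℤP.*-assoc (A i l) (B l k) (C k j))) ⟩
    sumℤ (λ k → sumℤ (λ l → A i l * (B l k * C k j)))   ≡⟨ sum-swap (λ k l → A i l * (B l k * C k j)) ⟩
    sumℤ (λ l → sumℤ (λ k → A i l * (B l k * C k j)))   ≡⟨ sum-cong (λ l → sum-*ˡ (A i l) (λ k → B l k * C k j)) ⟩
    sumℤ (λ l → A i l * sumℤ (λ k → B l k * C k j))     ∎
    where open ≡-Reasoning

  ∙-identityˡ : ∀ {m} (A : IM m) → δ ∙ A ≈ A
  ∙-identityˡ A i j = sum-δ i (λ l → A l j)

  ∙-identityʳ : ∀ {m} (A : IM m) → A ∙ δ ≈ A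
  ∙-identityʳ A i j = sum-δʳ j (λ l → A i l)

  ᵀ-∙ : ∀ {m} (A B : IM m) → (A ∙ B) ᵀ ≈ B ᵀ ∙ A ᵀ
  ᵀ-∙ A B i j = sum-cong (λ l → ℤP.*-comm (A j l) (B l i))

  diag : ∀ {m} → (Fin m → ℤ) → IM m
  diag d i j = d i * δ i j

  diag-∙ : ∀ {m} (d : Fin m → ℤ) (X : IM m) → diag d ∙ X ≈ (λ i j → d i * X i j)
  diag-∙ d X i j = trans (sum-cong (λ l → ℤP.*-assoc (d i) (δ i l) (X l j)))
    (trans (sum-*ˡ (d i) (λ l → δ i l * X l j)) (cong (d i *_) (sum-δ i (λ l → X l j))))

  ∙-diag : ∀ {m} (d : Fin m → ℤ) (X : IM m) → X ∙ diag d ≈ (λ i j → X i j * d j)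
  ∙-diag d X i j = trans (sum-cong (λ l → sym (ℤP.*-assoc (X i l) (d l) (δ l j))))
    (sum-δʳ j (λ l → X i l * d l))

  infix 4 _≋_mod_
  record _≋_mod_ {m} (A B : IM m) (q : ℤ) : Set where
    constructor entrywise
    field entry : ∀ i j → q ∣ A i j - B i j
  open _≋_mod_ public

  ≈⇒≋ : ∀ {m q} {A B : IM m} → A ≈ B → A ≋ B mod q
  ≈⇒≋ {A = A} e = entrywise λ i j →
    divides (+ 0) (trans (cong (_-_ (A i j)) (sym (e i j))) (ℤP.+-inverseʳ (A i j)))

  ≋-refl : ∀ {m q} {A : IM m} → A ≋ A mod q
  ≋-refl = ≈⇒≋ ≈-refl

  ≋-trans : ∀ {m q} {A B C : IM m} → A ≋ B mod q → B ≋ C mod q → A ≋ C mod q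
  ≋-trans {A = A} {B} {C} (entrywise d) (entrywise e) = entrywise λ i j →
    subst (_ ∣_) (telescope (A i j) (B i j) (C i j)) (∣m∣n⇒∣m+n (d i j) (e i j))

  ≋-sym : ∀ {m q} {A B : IM m} → A ≋ B mod q → B ≋ A mod q
  ≋-sym {A = A} {B} (entrywise d) = entrywise λ i j →
    subst (_ ∣_) (negate (A i j) (B i j)) (∣m⇒∣-m (d i j))
    where
    negate : ∀ a b → - (a - b) ≡ b - a
    negate = solve-∀

  ≋-weaken : ∀ {m q r} {A B : IM m} → q ∣ r → A ≋ B mod r → A ≋ B mod q
  ≋-weaken q∣r (entrywise d) = entrywise λ i j → ∣-trans q∣r (d i j)

  ∙-≋ : ∀ {m q} {A A′ B B′ : IM m} → A ≋ A′ mod q → B ≋ B′ mod q → A ∙ B ≋ A′ ∙ B′ mod q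
  ∙-≋ {q = q} {A} {A′} {B} {B′} (entrywise d) (entrywise e) = entrywise λ i j →
    subst (q ∣_) (sym (difference i j))
      (sum-∣ _ (λ l → ∣m∣n⇒∣m+n (∣n⇒∣m*n (B l j) (d i l)) (∣n⇒∣m*n (A′ i l) (e l j))))
    where
    split : ∀ a a′ b b′ → a * b - a′ * b′ ≡ b * (a - a′) + a′ * (b - b′)
    split = solve-∀
    difference : ∀ i j → (A ∙ B) i j - (A′ ∙ B′) i j ≡ sumℤ (λ l → B l j * (A i l - A′ i l) + A′ i l * (B l j - B′ l j))
    difference i j = begin
      sumℤ (λ l → A i l * B l j) - sumℤ (λ l → A′ i l * B′ l j)   ≡⟨ sym (sum-- (λ l → A i l * B l j) (λ l → A′ i l * B′ l j)) ⟩
      sumℤ (λ l → A i l * B l j - A′ i l * B′ l j)                ≡⟨ sum-cong (λ l → split (A i l) (A′ i l) (B l j) (B′ l j)) ⟩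
      sumℤ (λ l → B l j * (A i l - A′ i l) + A′ i l * (B l j - B′ l j)) ∎
      where open ≡-Reasoning

  ᵀ-≋ : ∀ {m q} {A B : IM m} → A ≋ B mod q → A ᵀ ≋ B ᵀ mod q
  ᵀ-≋ (entrywise d) = entrywise λ i j → d j i

  unit-parity : ∀ {s} → s ≡ + 1 ⊎ s ≡ - + 1 → ∀ x → + 2 ∣ s * x - x
  unit-parity (inj₁ refl) x = divides (+ 0) (cancel x)
    where
    cancel : ∀ x → + 1 * x - x ≡ + 0 * + 2
    cancel = solve-∀
  unit-parity (inj₂ refl) x = divides (- x) (double x)
    where
    double : ∀ x → - + 1 * x - x ≡ - x * + 2
    double = solve-∀

  𝐞 : ∀ {m} → Fin m → Fin m → IM m
  𝐞 u v a b = δ a u * δ b v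

  𝐞-∙ : ∀ {m} (u v : Fin m) (X : IM m) a b → (𝐞 u v ∙ X) a b ≡ δ a u * X v b
  𝐞-∙ u v X a b = begin
    sumℤ (λ l → δ a u * δ l v * X l b)   ≡⟨ sum-cong (λ l → trans (ℤP.*-assoc (δ a u) (δ l v) (X l b)) (cong (λ d → δ a u * (d * X l b)) (δ-sym l v))) ⟩
    sumℤ (λ l → δ a u * (δ v l * X l b)) ≡⟨ sum-*ˡ (δ a u) (λ l → δ v l * X l b) ⟩
    δ a u * sumℤ (λ l → δ v l * X l b)   ≡⟨ cong (δ a u *_) (sum-δ v (λ l → X l b)) ⟩
    δ a u * X v b                        ∎
    where
    open ≡-Reasoning

  1+_ : ∀ {m} → IM m → IM m
  (1+ X) a b = δ a b + X a b

  1+-∙ : ∀ {m} (X Y : IM m) → (1+ X) ∙ (1+ Y) ≈ 1+ (λ a b → X a b + Y a b + (X ∙ Y) a b)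
  1+-∙ {m} X Y a b = begin
    sumℤ (λ l → (δ a l + X a l) * (δ l b + Y l b))
      ≡⟨ sum-cong (λ l → expand (δ a l) (δ l b) (X a l) (Y l b)) ⟩
    sumℤ (λ l → f₁ l + (f₂ l + (f₃ l + f₄ l)))
      ≡⟨ trans (sum-+ f₁ _) (cong (_+_ (sumℤ f₁)) (trans (sum-+ f₂ _) (cong (_+_ (sumℤ f₂)) (sum-+ f₃ f₄)))) ⟩
    sumℤ f₁ + (sumℤ f₂ + (sumℤ f₃ + sumℤ f₄))
      ≡⟨ cong₂ _+_ (sum-δ a (λ l → δ l b)) (cong₂ _+_ (sum-δʳ b (X a)) (cong (_+ sumℤ f₄) (sum-δ a (λ l → Y l b)))) ⟩
    δ a b + (X a b + (Y a b + (X ∙ Y) a b))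
      ≡⟨ cong (_+_ (δ a b)) (sym (ℤP.+-assoc (X a b) (Y a b) _)) ⟩
    δ a b + (X a b + Y a b + (X ∙ Y) a b) ∎
    where
    open ≡-Reasoning
    f₁ f₂ f₃ f₄ : Fin m → ℤ
    f₁ l = δ a l * δ l b
    f₂ l = X a l * δ l b
    f₃ l = δ a l * Y l b
    f₄ l = X a l * Y l b
    expand : ∀ dₐ d_b x y → (dₐ + x) * (d_b + y) ≡ dₐ * d_b + (x * d_b + (dₐ * y + x * y))
    expand = solve-∀

  1+-cong : ∀ {k} {X Y : IM k} → X ≈ Y → 1+ X ≈ 1+ Y
  1+-cong X≈Y a b = cong (_+_ (δ a b)) (X≈Y a b)

  I+_·_ : ∀ {m} → ℤ → IM m → IM m
  (I+ y · N) a b = δ a b + y * N a b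

  SquareZero : ∀ {m} → IM m → Set
  SquareZero N = ∀ a b → (N ∙ N) a b ≡ + 0

  unipotent-∙ : ∀ {m} {N : IM m} → SquareZero N → ∀ y z → (I+ y · N) ∙ (I+ z · N) ≈ I+ (y + z) · N
  unipotent-∙ {N = N} N²≡0 y z a b = begin
    ((I+ y · N) ∙ (I+ z · N)) a b                     ≡⟨ 1+-∙ (λ a b → y * N a b) (λ a b → z * N a b) a b ⟩
    δ a b + (y * N a b + z * N a b + sumℤ (λ l → y * N a l * (z * N l b)))
      ≡⟨ cong (λ t → δ a b + (y * N a b + z * N a b + t))
              (trans (sum-cong (λ l → regroup y z (N a l) (N l b))) (trans (sum-*ˡ (y * z) (λ l → N a l * N l b)) (cong (y * z *_) (N²≡0 a b)))) ⟩
    δ a b + (y * N a b + z * N a b + y * z * + 0)     ≡⟨ collect y z (δ a b) (N a b) ⟩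
    δ a b + (y + z) * N a b                           ∎
    where
    open ≡-Reasoning
    regroup : ∀ y z u v → y * u * (z * v) ≡ y * z * (u * v)
    regroup = solve-∀
    collect : ∀ y z d n → d + (y * n + z * n + y * z * + 0) ≡ d + (y + z) * n
    collect = solve-∀

  unipotent-zero : ∀ {m} (N : IM m) → I+ (+ 0) · N ≈ δ
  unipotent-zero N a b = ℤP.+-identityʳ (δ a b)

  unipotent-inverse : ∀ {m} {N : IM m} → SquareZero N → ∀ y → (I+ y · N) ∙ (I+ (- y) · N) ≈ δ
  unipotent-inverse {N = N} N²≡0 y a b =
    trans (unipotent-∙ N²≡0 y (- y) a b)
          (trans (cong (λ c → δ a b + c * N a b) (ℤP.+-inverseʳ y)) (unipotent-zero N a b))

  unipotent-inverse′ : ∀ {m} {N : IM m} → SquareZero N → ∀ y → (I+ (- y) · N) ∙ (I+ y · N) ≈ δ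
  unipotent-inverse′ {N = N} N²≡0 y a b =
    trans (unipotent-∙ N²≡0 (- y) y a b)
          (trans (cong (λ c → δ a b + c * N a b) (ℤP.+-inverseˡ y)) (unipotent-zero N a b))

  unipotent-cong : ∀ {m} (N : IM m) {y z} → y ≡ z → I+ y · N ≈ I+ z · N
  unipotent-cong N refl _ _ = refl

  Involutive : ∀ {m} → (Fin m → ℤ) → Set
  Involutive d = ∀ a → d a * d a ≡ + 1

  diag-involutive : ∀ {m} {d : Fin m → ℤ} → Involutive d → diag d ∙ diag d ≈ δ
  diag-involutive {d = d} d²≡1 a b = begin
    (diag d ∙ diag d) a b ≡⟨ diag-∙ d (diag d) a b ⟩
    d a * (d a * δ a b)   ≡⟨ sym (ℤP.*-assoc (d a) (d a) (δ a b)) ⟩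
    d a * d a * δ a b     ≡⟨ cong (_* δ a b) (d²≡1 a) ⟩
    + 1 * δ a b           ≡⟨ ℤP.*-identityˡ (δ a b) ⟩
    δ a b                 ∎
    where open ≡-Reasoning

  Odd : ∀ {m} → (Fin m → ℤ) → IM m → Set
  Odd d N = ∀ a b → d a * N a b * d b ≡ - N a b

  diag-conjugate : ∀ {m} (d : Fin m → ℤ) (X : IM m) → diag d ∙ (X ∙ diag d) ≈ (λ a b → d a * X a b * d b)
  diag-conjugate d X a b = trans (diag-∙ d (X ∙ diag d) a b) (trans (cong (d a *_) (∙-diag d X a b))
    (sym (ℤP.*-assoc (d a) (X a b) (d b))))

  diag-conjugate-δ : ∀ {m} {d : Fin m → ℤ} → Involutive d → ∀ a b → d a * δ a b * d b ≡ δ a b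
  diag-conjugate-δ {d = d} d²≡1 a b = begin
    d a * δ a b * d b     ≡⟨ cong (_* d b) (ℤP.*-comm (d a) (δ a b)) ⟩
    δ a b * d a * d b     ≡⟨ cong (_* d b) (δ-subst a b d) ⟩
    δ a b * d b * d b     ≡⟨ ℤP.*-assoc (δ a b) (d b) (d b) ⟩
    δ a b * (d b * d b)   ≡⟨ cong (δ a b *_) (d²≡1 b) ⟩
    δ a b * + 1           ≡⟨ ℤP.*-identityʳ (δ a b) ⟩
    δ a b                 ∎
    where open ≡-Reasoning

  sign-flip : ∀ {m} {d : Fin m → ℤ} {N : IM m} → Involutive d → Odd d N →
    ∀ y → diag d ∙ ((I+ y · N) ∙ diag d) ≈ I+ (- y) · N
  sign-flip {d = d} {N} d²≡1 odd y a b = begin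
    (diag d ∙ ((I+ y · N) ∙ diag d)) a b          ≡⟨ diag-conjugate d (I+ y · N) a b ⟩
    d a * (δ a b + y * N a b) * d b               ≡⟨ distrib (d a) (d b) (δ a b) y (N a b) ⟩
    d a * δ a b * d b + y * (d a * N a b * d b)   ≡⟨ cong₂ (λ u v → u + y * v) (diag-conjugate-δ {d = d} d²≡1 a b) (odd a b) ⟩
    δ a b + y * - N a b                           ≡⟨ cong (_+_ (δ a b)) (trans (sym (ℤP.neg-distribʳ-* y (N a b))) (ℤP.neg-distribˡ-* y (N a b))) ⟩
    δ a b + - y * N a b                           ∎
    where
    open ≡-Reasoning
    distrib : ∀ x z e y n → x * (e + y * n) * z ≡ x * e * z + y * (x * n * z)
    distrib = solve-∀

  sign-commutator : ∀ {m} {d : Fin m → ℤ} {N : IM m} → Involutive d → Odd d N → SquareZero N →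
    ∀ y → diag d ∙ ((I+ y · N) ∙ (diag d ∙ (I+ (- y) · N))) ≈ I+ (- y + - y) · N
  sign-commutator {d = d} {N} d²≡1 odd N²≡0 y = begin
    diag d ∙ ((I+ y · N) ∙ (diag d ∙ (I+ (- y) · N)))   ≈⟨ ∙-cong {A = diag d} ≈-refl (≈-sym (∙-assoc (I+ y · N) (diag d) _)) ⟩
    diag d ∙ ((I+ y · N) ∙ diag d ∙ (I+ (- y) · N))     ≈⟨ ≈-sym (∙-assoc (diag d) _ _) ⟩
    diag d ∙ ((I+ y · N) ∙ diag d) ∙ (I+ (- y) · N)     ≈⟨ ∙-cong (sign-flip {d = d} {N} d²≡1 odd y) ≈-refl ⟩
    (I+ (- y) · N) ∙ (I+ (- y) · N)                     ≈⟨ unipotent-∙ N²≡0 (- y) (- y) ⟩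
    I+ (- y + - y) · N                                  ∎
    where open ≈-Reasoning

  𝐞-conjugate : ∀ {m} (d : Fin m → ℤ) (u v a b : Fin m) → d a * 𝐞 u v a b * d b ≡ d u * d v * 𝐞 u v a b
  𝐞-conjugate d u v a b = begin
    d a * (δ a u * δ b v) * d b     ≡⟨ reorder (d a) (d b) (δ a u) (δ b v) ⟩
    δ a u * δ b v * (d a * d b)     ≡⟨ δδ-subst a u b v (λ a b → d a * d b) ⟩
    δ a u * δ b v * (d u * d v)     ≡⟨ ℤP.*-comm (δ a u * δ b v) (d u * d v) ⟩
    d u * d v * (δ a u * δ b v)     ∎
    where
    open ≡-Reasoning
    reorder : ∀ x y e f → x * (e * f) * y ≡ e * f * (x * y)
    reorder = solve-∀

  cancel-inverse : ∀ {m} (X Y Z : IM m) → X ∙ Y ≈ δ → X ∙ (Y ∙ Z) ≈ Z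
  cancel-inverse X Y Z XY≈δ = ≈-trans (≈-sym (∙-assoc X Y Z)) (≈-trans (∙-cong XY≈δ (≈-refl {A = Z})) (∙-identityˡ Z))

  commutator-inverse : ∀ {m} (A A′ B B′ : IM m) → A ∙ A′ ≈ δ → A′ ∙ A ≈ δ → B ∙ B′ ≈ δ → B′ ∙ B ≈ δ →
    (A ∙ (B ∙ (A′ ∙ B′))) ∙ (B ∙ (A ∙ (B′ ∙ A′))) ≈ δ
  commutator-inverse {m} A A′ B B′ AA′ A′A BB′ B′B = begin
    (A ∙ (B ∙ (A′ ∙ B′))) ∙ Y              ≈⟨ ∙-assoc A (B ∙ (A′ ∙ B′)) Y ⟩
    A ∙ ((B ∙ (A′ ∙ B′)) ∙ Y)              ≈⟨ ∙-cong (≈-refl {A = A}) (∙-assoc B (A′ ∙ B′) Y) ⟩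
    A ∙ (B ∙ ((A′ ∙ B′) ∙ Y))              ≈⟨ ∙-cong (≈-refl {A = A}) (∙-cong (≈-refl {A = B}) (∙-assoc A′ B′ Y)) ⟩
    A ∙ (B ∙ (A′ ∙ (B′ ∙ (B ∙ (A ∙ (B′ ∙ A′))))))
      ≈⟨ ∙-cong (≈-refl {A = A}) (∙-cong (≈-refl {A = B}) (∙-cong (≈-refl {A = A′}) (cancel-inverse B′ B _ B′B))) ⟩
    A ∙ (B ∙ (A′ ∙ (A ∙ (B′ ∙ A′))))       ≈⟨ ∙-cong (≈-refl {A = A}) (∙-cong (≈-refl {A = B}) (cancel-inverse A′ A _ A′A)) ⟩
    A ∙ (B ∙ (B′ ∙ A′))                    ≈⟨ ∙-cong (≈-refl {A = A}) (cancel-inverse B B′ A′ BB′) ⟩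
    A ∙ A′                                 ≈⟨ AA′ ⟩
    δ                                      ∎
    where
    open ≈-Reasoning
    Y : IM m
    Y = B ∙ (A ∙ (B′ ∙ A′))

  𝐞-on : ∀ {m} (u v : Fin m) → 𝐞 u v u v ≡ + 1
  𝐞-on u v = cong₂ _*_ (δ-diag u) (δ-diag v)

  𝐞-off : ∀ {m} {u v a b : Fin m} → ¬ (a ≡ u × b ≡ v) → 𝐞 u v a b ≡ + 0
  𝐞-off {u = u} {v} {a} {b} off with a ≟ u | b ≟ v
  ... | yes refl | yes refl = contradiction (refl , refl) off
  ... | yes refl | no b≢v = refl
  ... | no a≢u | _ = refl

  -- Adding W to U keeps every entry where W vanishes and makes all other entries even.
  Settles : ∀ {m} → IM m → IM m → Set
  Settles U W = ∀ a b → W a b ≡ + 0 ⊎ + 2 ∣ W a b + U a b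

  at? : ∀ {m} (a b u v : Fin m) → Dec (a ≡ u × b ≡ v)
  at? a b u v = (a ≟ u) ×-dec (b ≟ v)

  single-at : ∀ {m} (u v : Fin m) c → c * 𝐞 u v u v ≡ c
  single-at u v c = trans (cong (c *_) (𝐞-on u v)) (ℤP.*-identityʳ c)

  settles-single : ∀ {m} (U : IM m) u v c → + 2 ∣ c + U u v → Settles U (λ a b → c * 𝐞 u v a b)
  settles-single U u v c even a b with at? a b u v
  ... | yes (refl , refl) = inj₂ (subst (λ w → + 2 ∣ w + U u v) (sym (single-at u v c)) even)
  ... | no off = inj₁ (trans (cong (c *_) (𝐞-off off)) (ℤP.*-zeroʳ c))

  pair-at : ∀ {m} {u v u′ v′ : Fin m} c c′ → ¬ (u ≡ u′ × v ≡ v′) → c * 𝐞 u v u v + c′ * 𝐞 u′ v′ u v ≡ c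
  pair-at {u = u} {v} c c′ distinct =
    trans (cong₂ _+_ (single-at u v c) (trans (cong (c′ *_) (𝐞-off distinct)) (ℤP.*-zeroʳ c′))) (ℤP.+-identityʳ c)

  pair-at′ : ∀ {m} {u v u′ v′ : Fin m} c c′ → ¬ (u ≡ u′ × v ≡ v′) → c * 𝐞 u v u′ v′ + c′ * 𝐞 u′ v′ u′ v′ ≡ c′
  pair-at′ {u′ = u′} {v′} c c′ distinct =
    trans (cong₂ _+_ (trans (cong (c *_) (𝐞-off (λ (u′≡u , v′≡v) → distinct (sym u′≡u , sym v′≡v)))) (ℤP.*-zeroʳ c)) (single-at u′ v′ c′))
          (ℤP.+-identityˡ c′)

  settles-pair : ∀ {m} (U : IM m) u v u′ v′ c c′ → ¬ (u ≡ u′ × v ≡ v′) → + 2 ∣ c + U u v → + 2 ∣ c′ + U u′ v′ →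
    Settles U (λ a b → c * 𝐞 u v a b + c′ * 𝐞 u′ v′ a b)
  settles-pair U u v u′ v′ c c′ distinct even even′ a b with at? a b u v | at? a b u′ v′
  ... | yes (refl , refl) | _ = inj₂ (subst (λ w → + 2 ∣ w + U u v) (sym (pair-at c c′ distinct)) even)
  ... | no _ | yes (refl , refl) = inj₂ (subst (λ w → + 2 ∣ w + U u′ v′) (sym (pair-at′ c c′ distinct)) even′)
  ... | no off | no off′ = inj₁ (trans (cong₂ (λ x y → c * x + c′ * y) (𝐞-off off) (𝐞-off off′))
                                       (cong₂ _+_ (ℤP.*-zeroʳ c) (ℤP.*-zeroʳ c′)))

  settles-≈ : ∀ {m} {U W W′ : IM m} → W ≈ W′ → Settles U W′ → Settles U W
  settles-≈ {U = U} W≈W′ settles a b with settles a b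
  ... | inj₁ vanishes = inj₁ (trans (W≈W′ a b) vanishes)
  ... | inj₂ even = inj₂ (subst (λ w → + 2 ∣ w + U a b) (sym (W≈W′ a b)) even)

  -- The law (I + C)(I + C′) = I + (C ⊛ C′) written on the "C" part.
  _⊛_ : ∀ {k} → IM k → IM k → IM k
  (C ⊛ C′) r s = C r s + C′ r s + (C ∙ C′) r s

  mat2 : ℤ → ℤ → ℤ → ℤ → IM 2
  mat2 a b c d zero zero = a
  mat2 a b c d zero (suc zero) = b
  mat2 a b c d (suc zero) zero = c
  mat2 a b c d (suc zero) (suc zero) = d

  mat2-⊛ : ∀ a b c d a′ b′ c′ d′ → mat2 a b c d ⊛ mat2 a′ b′ c′ d′ ≈
    mat2 (a + a′ + (a * a′ + b * c′)) (b + b′ + (a * b′ + b * d′)) (c + c′ + (c * a′ + d * c′)) (d + d′ + (c * b′ + d * d′))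
  mat2-⊛ a b c d a′ b′ c′ d′ zero zero = cong (λ t → a + a′ + (a * a′ + t)) (ℤP.+-identityʳ (b * c′))
  mat2-⊛ a b c d a′ b′ c′ d′ zero (suc zero) = cong (λ t → b + b′ + (a * b′ + t)) (ℤP.+-identityʳ (b * d′))
  mat2-⊛ a b c d a′ b′ c′ d′ (suc zero) zero = cong (λ t → c + c′ + (c * a′ + t)) (ℤP.+-identityʳ (d * c′))
  mat2-⊛ a b c d a′ b′ c′ d′ (suc zero) (suc zero) = cong (λ t → d + d′ + (c * b′ + t)) (ℤP.+-identityʳ (d * d′))

  mat2-cong : ∀ {a b c d a′ b′ c′ d′} → a ≡ a′ → b ≡ b′ → c ≡ c′ → d ≡ d′ → mat2 a b c d ≈ mat2 a′ b′ c′ d′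
  mat2-cong refl refl refl refl = ≈-refl

  -- Embedding k×k matrices into m×m matrices along an injective map of indices e.
  module Block {k m : ℕ} (e : Fin k → Fin m) (e-δ : ∀ r s → δ (e r) (e s) ≡ δ r s) where

    block : IM k → IM m
    block C a b = sumℤ (λ r → sumℤ (λ s → δ a (e r) * C r s * δ b (e s)))

    block-∙ : ∀ C (X : IM m) a b → (block C ∙ X) a b ≡ sumℤ (λ r → sumℤ (λ s → δ a (e r) * C r s * X (e s) b))
    block-∙ C X a b = begin
      sumℤ (λ l → sumℤ (λ r → sumℤ (λ s → T r s * δ l (e s))) * X l b)
        ≡⟨ sum-cong (λ l → trans (sum-*ʳ (X l b) (λ r → sumℤ (λ s → T r s * δ l (e s)))) (sum-cong (λ r → sum-*ʳ (X l b) (λ s → T r s * δ l (e s))))) ⟩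
      sumℤ (λ l → sumℤ (λ r → sumℤ (λ s → T r s * δ l (e s) * X l b)))
        ≡⟨ trans (sum-swap (λ l r → sumℤ (λ s → T r s * δ l (e s) * X l b))) (sum-cong (λ r → sum-swap (λ l s → T r s * δ l (e s) * X l b))) ⟩
      sumℤ (λ r → sumℤ (λ s → sumℤ (λ l → T r s * δ l (e s) * X l b)))
        ≡⟨ sum-cong (λ r → sum-cong (λ s → pick (T r s) (e s))) ⟩
      sumℤ (λ r → sumℤ (λ s → T r s * X (e s) b)) ∎
      where
      open ≡-Reasoning
      T : Fin k → Fin k → ℤ
      T r s = δ a (e r) * C r s
      pick : ∀ t u → sumℤ (λ l → t * δ l u * X l b) ≡ t * X u b
      pick t u = trans (sum-cong (λ l → trans (ℤP.*-assoc t (δ l u) (X l b)) (cong (λ d → t * (d * X l b)) (δ-sym l u))))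
        (trans (sum-*ˡ t (λ l → δ u l * X l b)) (cong (t *_) (sum-δ u (λ l → X l b))))

    block-row : ∀ C s b → block C (e s) b ≡ sumℤ (λ s′ → C s s′ * δ b (e s′))
    block-row C s b = begin
      sumℤ (λ r → sumℤ (λ s′ → δ (e s) (e r) * C r s′ * δ b (e s′)))
        ≡⟨ sum-cong (λ r → trans (sum-cong (λ s′ → trans (ℤP.*-assoc (δ (e s) (e r)) (C r s′) (δ b (e s′))) (cong (λ d → d * (C r s′ * δ b (e s′))) (e-δ s r))))
                                  (sum-*ˡ (δ s r) (λ s′ → C r s′ * δ b (e s′)))) ⟩
      sumℤ (λ r → δ s r * sumℤ (λ s′ → C r s′ * δ b (e s′)))
        ≡⟨ sum-δ s (λ r → sumℤ (λ s′ → C r s′ * δ b (e s′))) ⟩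
      sumℤ (λ s′ → C s s′ * δ b (e s′)) ∎
      where open ≡-Reasoning

    block-∙-block : ∀ C C′ → block C ∙ block C′ ≈ block (C ∙ C′)
    block-∙-block C C′ a b = begin
      (block C ∙ block C′) a b
        ≡⟨ block-∙ C (block C′) a b ⟩
      sumℤ (λ r → sumℤ (λ s → δ a (e r) * C r s * block C′ (e s) b))
        ≡⟨ sum-cong (λ r → sum-cong (λ s → trans (cong (δ a (e r) * C r s *_) (block-row C′ s b))
                                                 (sym (sum-*ˡ (δ a (e r) * C r s) (λ s′ → C′ s s′ * δ b (e s′)))))) ⟩
      sumℤ (λ r → sumℤ (λ s → sumℤ (λ s′ → δ a (e r) * C r s * (C′ s s′ * δ b (e s′)))))
        ≡⟨ sum-cong (λ r → sum-swap (λ s s′ → δ a (e r) * C r s * (C′ s s′ * δ b (e s′)))) ⟩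
      sumℤ (λ r → sumℤ (λ s′ → sumℤ (λ s → δ a (e r) * C r s * (C′ s s′ * δ b (e s′)))))
        ≡⟨ sum-cong (λ r → sum-cong (λ s′ → trans (sum-cong (λ s → regroup (δ a (e r)) (C r s) (C′ s s′) (δ b (e s′))))
             (trans (sym (sum-*ʳ (δ b (e s′)) (λ s → δ a (e r) * (C r s * C′ s s′))))
                    (cong (_* δ b (e s′)) (sum-*ˡ (δ a (e r)) (λ s → C r s * C′ s s′)))))) ⟩
      sumℤ (λ r → sumℤ (λ s′ → δ a (e r) * (C ∙ C′) r s′ * δ b (e s′))) ∎
      where
      open ≡-Reasoning
      regroup : ∀ d c c′ f → d * c * (c′ * f) ≡ d * (c * c′) * f
      regroup = solve-∀

    block-+ : ∀ C D a b → block (λ r s → C r s + D r s) a b ≡ block C a b + block D a b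
    block-+ C D a b = trans (sum-cong (λ r → trans (sum-cong (λ s → distrib (δ a (e r)) (C r s) (D r s) (δ b (e s))))
                                                   (sum-+ (λ s → δ a (e r) * C r s * δ b (e s)) (λ s → δ a (e r) * D r s * δ b (e s)))))
                            (sum-+ (λ r → sumℤ (λ s → δ a (e r) * C r s * δ b (e s))) (λ r → sumℤ (λ s → δ a (e r) * D r s * δ b (e s))))
      where
      distrib : ∀ x c d y → x * (c + d) * y ≡ x * c * y + x * d * y
      distrib = solve-∀

    block-cong : ∀ {C C′} → C ≈ C′ → ∀ a b → block C a b ≡ block C′ a b
    block-cong C≈C′ a b = sum-cong (λ r → sum-cong (λ s → cong (λ c → δ a (e r) * c * δ b (e s)) (C≈C′ r s)))

    1+block-∙ : ∀ C C′ → (1+ block C) ∙ (1+ block C′) ≈ 1+ block (C ⊛ C′)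
    1+block-∙ C C′ a b = begin
      ((1+ block C) ∙ (1+ block C′)) a b
        ≡⟨ 1+-∙ (block C) (block C′) a b ⟩
      δ a b + (block C a b + block C′ a b + (block C ∙ block C′) a b)
        ≡⟨ cong (λ t → δ a b + (block C a b + block C′ a b + t)) (block-∙-block C C′ a b) ⟩
      δ a b + (block C a b + block C′ a b + block (C ∙ C′) a b)
        ≡⟨ cong (_+_ (δ a b)) (sym (trans (block-+ (λ r s → C r s + C′ r s) (C ∙ C′) a b) (cong (_+ block (C ∙ C′) a b) (block-+ C C′ a b)))) ⟩
      δ a b + block (C ⊛ C′) a b ∎
      where open ≡-Reasoning

  2^_ : ℕ → ℤ
  2^ n = + (2 ℕ.^ n)

  2^-suc : ∀ n → 2^ suc n ≡ + 2 * 2^ n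
  2^-suc n = ℤP.pos-* 2 (2 ℕ.^ n)

  2^-∣-suc : ∀ n → 2^ n ∣ 2^ suc n
  2^-∣-suc n = divides (+ 2) (2^-suc n)

  2^-mono : ∀ {a b} → a ≤ b → 2^ a ∣ 2^ b
  2^-mono {a} {b} a≤b = subst (λ c → 2^ a ∣ 2^ c) (ℕP.m∸n+n≡m a≤b) (go (b ℕ.∸ a))
    where
    go : ∀ d → 2^ a ∣ 2^ (d ℕ.+ a)
    go zero = divides (+ 1) (sym (ℤP.*-identityˡ (2^ a)))
    go (suc d) = ∣-trans (go d) (2^-∣-suc (d ℕ.+ a))

  -- 2ⁿ⁺² divides (2ⁿ⁺¹)², which makes the expansion below additive.
  2^-∣-square : ∀ n → 2^ suc (suc n) ∣ 2^ suc n * 2^ suc n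
  2^-∣-square n = divides (2^ n) (begin
    2^ suc n * 2^ suc n              ≡⟨ cong₂ _*_ (2^-suc n) refl ⟩
    + 2 * 2^ n * 2^ suc n            ≡⟨ regroup (2^ n) (2^ suc n) ⟩
    2^ n * (+ 2 * 2^ suc n)          ≡⟨ cong (2^ n *_) (sym (2^-suc (suc n))) ⟩
    2^ n * 2^ suc (suc n)            ∎)
    where
    open ≡-Reasoning
    regroup : ∀ p q → + 2 * p * q ≡ p * (+ 2 * q)
    regroup = solve-∀

  Expansion : ∀ {m} → ℕ → IM m → IM m → Set
  Expansion n N U = N ≋ I+ 2^ n · U mod 2^ suc n

  expansion-∙ : ∀ {m} n (X Y U V : IM m) → Expansion (suc n) X U → Expansion (suc n) Y V →
    Expansion (suc n) (X ∙ Y) (λ a b → U a b + V a b)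
  expansion-∙ {m} n X Y U V eX eY = ≋-trans (∙-≋ eX eY) (≋-trans (≈⇒≋ (1+-∙ QU QV)) (entrywise quadratic))
    where
    Q : ℤ
    Q = 2^ suc n
    QU QV : IM m
    QU a b = Q * U a b
    QV a b = Q * V a b
    quadratic : ∀ a b → 2^ suc (suc n) ∣ (δ a b + (QU a b + QV a b + (QU ∙ QV) a b)) - (δ a b + Q * (U a b + V a b))
    quadratic a b = subst (2^ suc (suc n) ∣_) (sym difference) (∣m⇒∣m*n ((U ∙ V) a b) (2^-∣-square n))
      where
      open ≡-Reasoning
      regroup : ∀ q u v → q * u * (q * v) ≡ q * q * (u * v)
      regroup = solve-∀
      cancel : ∀ d q u v s → d + (q * u + q * v + s) - (d + q * (u + v)) ≡ s
      cancel = solve-∀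
      difference : (δ a b + (QU a b + QV a b + (QU ∙ QV) a b)) - (δ a b + Q * (U a b + V a b)) ≡ Q * Q * (U ∙ V) a b
      difference = begin
        (δ a b + (QU a b + QV a b + (QU ∙ QV) a b)) - (δ a b + Q * (U a b + V a b))
          ≡⟨ cancel (δ a b) Q (U a b) (V a b) ((QU ∙ QV) a b) ⟩
        sumℤ (λ l → Q * U a l * (Q * V l b))
          ≡⟨ trans (sum-cong (λ l → regroup Q (U a l) (V l b))) (sum-*ˡ (Q * Q) (λ l → U a l * V l b)) ⟩
        Q * Q * (U ∙ V) a b ∎

  expansion-intro : ∀ {m} n (N : IM m) → N ≋ δ mod 2^ n → Σ (IM m) (Expansion n N)
  expansion-intro {m} n N (entrywise d) = U , entrywise λ a b → divides (+ 0) (exact (N a b) (δ a b) (U a b) (2^ n) (proof a b))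
    where
    U : IM m
    U a b = _∣_.quotient (d a b)
    proof : ∀ a b → N a b - δ a b ≡ U a b * 2^ n
    proof a b = _∣_.equality (d a b)
    exact : ∀ x e u q → x - e ≡ u * q → x - (e + q * u) ≡ + 0 * 2^ suc n
    exact x e u q eq = trans (rearrange x e q u) (trans (cong (_- q * u) eq) (cancel u q))
      where
      rearrange : ∀ x e q u → x - (e + q * u) ≡ (x - e) - q * u
      rearrange = solve-∀
      cancel : ∀ u q → u * q - q * u ≡ + 0
      cancel = solve-∀

  expansion-done : ∀ {m} n (N U : IM m) → Expansion n N U → (∀ a b → + 2 ∣ U a b) → N ≋ δ mod 2^ suc n
  expansion-done n N U (entrywise e) U-even = entrywise λ a b →
    subst (2^ suc n ∣_) (add-back (N a b) (δ a b) (2^ n * U a b)) (∣m∣n⇒∣m+n (e a b) (2^-times-even (U-even a b)))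
    where
    add-back : ∀ x d u → x - (d + u) + u ≡ x - d
    add-back = solve-∀
    2^-times-even : ∀ {u} → + 2 ∣ u → 2^ suc n ∣ 2^ n * u
    2^-times-even {u} (divides t refl) = divides t (trans (regroup (2^ n) t) (cong (t *_) (sym (2^-suc n))))
      where
      regroup : ∀ p t → p * (t * + 2) ≡ t * (+ 2 * p)
      regroup = solve-∀

  coherent-∣ : ∀ (x : Z2) → Coherent x → ∀ {a b} → a ≤ b → 2^ a ∣ x b - x a
  coherent-∣ x coh {a} {b} a≤b = subst (λ c → 2^ a ∣ x c - x a) (ℕP.m∸n+n≡m a≤b) (go (b ℕ.∸ a))
    where
    go : ∀ d → 2^ a ∣ x (d ℕ.+ a) - x a
    go zero = divides (+ 0) (ℤP.+-inverseʳ (x a))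
    go (suc d) = subst (2^ a ∣_) (telescope (x (suc d ℕ.+ a)) (x (d ℕ.+ a)) (x a))
      (∣m∣n⇒∣m+n (∣-trans (2^-mono (ℕP.m≤n+m a d)) (∣ᵤ⇒∣ {k = 2^ (d ℕ.+ a)} {i = x (suc d ℕ.+ a) - x (d ℕ.+ a)} (coh (d ℕ.+ a)))) (go d))

  const : ∀ {n} → IM n → Mat n
  const A i j _ = A i j

  level : ∀ {n} → ℕ → Mat n → IM n
  level k C i j = C i j k

  ≋⇒CongMat : ∀ {n} k (A B : Mat n) → level k A ≋ level k B mod 2^ k → CongMat k A B
  ≋⇒CongMat k A B (entrywise d) i j = ∣⇒∣ᵤ (d i j)

  CongMat⇒≋ : ∀ {n} k (A B : Mat n) → CongMat k A B → level k A ≋ level k B mod 2^ k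
  CongMat⇒≋ k A B c = entrywise λ i j → ∣ᵤ⇒∣ (c i j)

  ≈⇒EqMat : ∀ {n} (A B : IM n) → A ≈ B → EqMat (const A) (const B)
  ≈⇒EqMat A B A≈B k = ≋⇒CongMat k (const A) (const B) (≈⇒≋ A≈B)

  level-near-identity : ∀ {n} (M : Mat n) → CoherentMat M → CongMat 2 M idM →
    ∀ {j k} → j ≤ k → j ≤ 2 → level k M ≋ δ mod 2^ j
  level-near-identity M coh M≡I {j} {k} j≤k j≤2 = entrywise λ a b → via-level-2 a b (ℕP.≤-total 2 k)
    where
    M≡I-at-2 : ∀ a b → 2^ j ∣ M a b 2 - idM a b 2
    M≡I-at-2 a b = ∣-trans (2^-mono j≤2) (entry (CongMat⇒≋ 2 M idM M≡I) a b)
    swap : ∀ u v w → - (v - u) + (v - w) ≡ u - w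
    swap = solve-∀
    via-level-2 : ∀ a b → 2 ≤ k ⊎ k ≤ 2 → 2^ j ∣ M a b k - idM a b k
    via-level-2 a b (inj₁ 2≤k) = subst (2^ j ∣_) (telescope (M a b k) (M a b 2) (idM a b k))
      (∣m∣n⇒∣m+n (∣-trans (2^-mono j≤2) (coherent-∣ (M a b) (coh a b) 2≤k)) (M≡I-at-2 a b))
    via-level-2 a b (inj₂ k≤2) = subst (2^ j ∣_) (swap (M a b k) (M a b 2) (idM a b k))
      (∣m∣n⇒∣m+n (∣m⇒∣-m (∣-trans (2^-mono j≤k) (coherent-∣ (M a b) (coh a b) k≤2))) (M≡I-at-2 a b))


  module Symplectic (g : ℕ) where

    -- The standard symplectic basis of ℤ^{2g}: index i < g is paired with i + g.
    m : ℕ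
    m = 2 ℕ.* g

    index<g+g : (i : Fin m) → toℕ i < g ℕ.+ g
    index<g+g i = subst (toℕ i <_) (cong (g ℕ.+_) (ℕP.+-identityʳ g)) (FP.toℕ<n i)

    Partners : Fin m → Fin m → Set
    Partners i j = toℕ i < g × toℕ j ≡ toℕ i ℕ.+ g

    partner : Fin m → Fin m
    partner i with toℕ i ℕP.<? g
    ... | yes i<g = fromℕ< (subst (toℕ i ℕ.+ g <_) (cong (g ℕ.+_) (sym (ℕP.+-identityʳ g))) (ℕP.+-monoˡ-< g i<g))
    ... | no _ = fromℕ< (ℕP.≤-<-trans (ℕP.m∸n≤m (toℕ i) g) (FP.toℕ<n i))

    partners : ∀ i → Partners i (partner i) ⊎ Partners (partner i) i
    partners i with toℕ i ℕP.<? g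
    ... | yes i<g = inj₁ (i<g , FP.toℕ-fromℕ< _)
    ... | no i≮g = inj₂ (lower , upper)
      where
      g≤i : g ≤ toℕ i
      g≤i = ℕP.≮⇒≥ i≮g
      upper : toℕ i ≡ toℕ (fromℕ< _) ℕ.+ g
      upper = trans (sym (ℕP.m∸n+n≡m g≤i)) (cong (ℕ._+ g) (sym (FP.toℕ-fromℕ< _)))
      lower : toℕ (fromℕ< _) < g
      lower = ℕP.+-cancelʳ-< g _ g (subst (_< g ℕ.+ g) upper (index<g+g i))

    partners-functional : ∀ {i j j′} → Partners i j → Partners i j′ → j ≡ j′
    partners-functional (_ , j≡) (_ , j′≡) = FP.toℕ-injective (trans j≡ (sym j′≡))

    partners-injective : ∀ {i i′ j} → Partners i j → Partners i′ j → i ≡ i′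
    partners-injective (_ , j≡) (_ , j≡′) = FP.toℕ-injective (ℕP.+-cancelʳ-≡ _ _ _ (trans (sym j≡) j≡′))

    Partners-upper : ∀ {i j} → Partners i j → ¬ toℕ j < g
    Partners-upper (_ , j≡) j<g = ℕP.<⇒≱ j<g (subst (g ≤_) (sym j≡) (ℕP.m≤n+m g _))

    partners-no-chain : ∀ {i j k} → Partners i j → ¬ Partners j k
    partners-no-chain ij (j<g , _) = Partners-upper ij j<g

    Partners⇒partner : ∀ {i j} → Partners i j → j ≡ partner i
    Partners⇒partner {i} ij with partners i
    ... | inj₁ ip = partners-functional ij ip
    ... | inj₂ pi = contradiction ij (partners-no-chain pi)

    Partners⇒partner′ : ∀ {i j} → Partners j i → j ≡ partner i
    Partners⇒partner′ {i} ji with partners i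
    ... | inj₁ ip = contradiction ip (partners-no-chain ji)
    ... | inj₂ pi = partners-injective ji pi

    partner-involutive : ∀ i → partner (partner i) ≡ i
    partner-involutive i with partners i
    ... | inj₁ ip = sym (Partners⇒partner′ ip)
    ... | inj₂ pi = sym (Partners⇒partner pi)

    partner-injective : ∀ {i j} → partner i ≡ partner j → i ≡ j
    partner-injective {i} {j} e = trans (sym (partner-involutive i)) (trans (cong partner e) (partner-involutive j))

    no-self-partner : ∀ {i} → ¬ Partners i i
    no-self-partner ii = partners-no-chain ii ii

    partner-fixfree : ∀ i → ¬ partner i ≡ i
    partner-fixfree i e with partners i
    ... | inj₁ ip = no-self-partner (subst (Partners i) e ip)
    ... | inj₂ pi = no-self-partner (subst (λ k → Partners k i) e pi)

    -- The sign +1 on lower indices and -1 on upper ones; J = diag(sign) · (partner permutation).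
    sign : Fin m → ℤ
    sign i = if ⌊ toℕ i ℕP.<? g ⌋ then + 1 else - + 1

    sign-lower : ∀ {i} → toℕ i < g → sign i ≡ + 1
    sign-lower {i} i<g with toℕ i ℕP.<? g
    ... | yes _ = refl
    ... | no i≮g = contradiction i<g i≮g

    sign-upper : ∀ {i} → ¬ toℕ i < g → sign i ≡ - + 1
    sign-upper {i} i≮g with toℕ i ℕP.<? g
    ... | yes i<g = contradiction i<g i≮g
    ... | no _ = refl

    sign-Partners : ∀ {i j} → Partners i j → sign j ≡ - sign i
    sign-Partners ij@(i<g , _) = trans (sign-upper (Partners-upper ij)) (cong -_ (sym (sign-lower i<g)))

    sign-partner : ∀ i → sign (partner i) ≡ - sign i
    sign-partner i with partners i
    ... | inj₁ ip = sign-Partners ip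
    ... | inj₂ pi = trans (sym (ℤP.neg-involutive _)) (cong -_ (sym (sign-Partners pi)))

    sign-square : ∀ i → sign i * sign i ≡ + 1
    sign-square i with toℕ i ℕP.<? g
    ... | yes _ = refl
    ... | no _ = refl

    sign-unit : ∀ a → sign a ≡ + 1 ⊎ sign a ≡ - + 1
    sign-unit a with toℕ a ℕP.<? g
    ... | yes _ = inj₁ refl
    ... | no _ = inj₂ refl

    δ-partner : ∀ a b → δ (partner a) (partner b) ≡ δ a b
    δ-partner a b with a FP.≟ b
    ... | yes refl = δ-diag (partner a)
    ... | no a≢b = δ-off (λ e → a≢b (partner-injective e))

    δ-partnerˡ : ∀ a b → δ (partner a) b ≡ δ a (partner b)
    δ-partnerˡ a b = trans (cong (δ (partner a)) (sym (partner-involutive b))) (δ-partner a (partner b))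

    Jm : IM m
    Jm i j = sign i * δ j (partner i)

    private
      if-≡ᵇ-true : ∀ {x y} {a b : ℤ} → x ≡ y → (if x ≡ᵇ y then a else b) ≡ a
      if-≡ᵇ-true {x} {y} x≡y with x ≡ᵇ y | ℕP.≡⇒≡ᵇ x y x≡y
      ... | true | _ = refl

      if-≡ᵇ-false : ∀ {x y} {a b : ℤ} → ¬ x ≡ y → (if x ≡ᵇ y then a else b) ≡ b
      if-≡ᵇ-false {x} {y} x≢y with x ≡ᵇ y | ℕP.≡ᵇ⇒≡ x y
      ... | false | _ = refl
      ... | true | x≡y = contradiction (x≡y _) x≢y

      shifted⇒Partners : ∀ {i j} → toℕ j ≡ toℕ i ℕ.+ g → Partners i j
      shifted⇒Partners {i} {j} j≡ = ℕP.+-cancelʳ-< g _ g (subst (_< g ℕ.+ g) j≡ (index<g+g j)) , j≡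

    J-entry : ∀ i j n → J g i j n ≡ Jm i j
    J-entry i j n with j FP.≟ partner i
    ... | no j≢pi = begin
      (if toℕ j ≡ᵇ toℕ i ℕ.+ g then + 1 else if toℕ i ≡ᵇ toℕ j ℕ.+ g then - + 1 else + 0)
        ≡⟨ if-≡ᵇ-false (λ e → j≢pi (Partners⇒partner (shifted⇒Partners e))) ⟩
      (if toℕ i ≡ᵇ toℕ j ℕ.+ g then - + 1 else + 0)
        ≡⟨ if-≡ᵇ-false (λ e → j≢pi (Partners⇒partner′ (shifted⇒Partners e))) ⟩
      + 0
        ≡⟨ sym (ℤP.*-zeroʳ (sign i)) ⟩
      sign i * + 0 ∎
      where open ≡-Reasoning
    ... | yes refl with partners i
    ...   | inj₁ ip@(i<g , pi≡) = trans (if-≡ᵇ-true pi≡) (cong (_* + 1) (sym (sign-lower i<g)))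
    ...   | inj₂ pi@(_ , i≡) = begin
      (if toℕ (partner i) ≡ᵇ toℕ i ℕ.+ g then + 1 else if toℕ i ≡ᵇ toℕ (partner i) ℕ.+ g then - + 1 else + 0)
        ≡⟨ if-≡ᵇ-false {toℕ (partner i)} (λ e → partners-no-chain pi (shifted⇒Partners e)) ⟩
      (if toℕ i ≡ᵇ toℕ (partner i) ℕ.+ g then - + 1 else + 0)
        ≡⟨ if-≡ᵇ-true i≡ ⟩
      - + 1
        ≡⟨ cong (_* + 1) (sym (sign-upper (Partners-upper pi))) ⟩
      sign i * + 1 ∎
      where open ≡-Reasoning

    Jm-∙ : ∀ (Y : IM m) l b → (Jm ∙ Y) l b ≡ sign l * Y (partner l) b
    Jm-∙ Y l b = begin
      sumℤ (λ k → sign l * δ k (partner l) * Y k b)   ≡⟨ sum-cong (λ k → trans (ℤP.*-assoc (sign l) _ (Y k b)) (cong (λ d → sign l * (d * Y k b)) (δ-sym k (partner l)))) ⟩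
      sumℤ (λ k → sign l * (δ (partner l) k * Y k b)) ≡⟨ sum-*ˡ (sign l) (λ k → δ (partner l) k * Y k b) ⟩
      sign l * sumℤ (λ k → δ (partner l) k * Y k b)   ≡⟨ cong (sign l *_) (sum-δ (partner l) (λ k → Y k b)) ⟩
      sign l * Y (partner l) b                         ∎
      where open ≡-Reasoning

    pairing : ∀ (X Y : IM m) a b → (X ᵀ ∙ (Jm ∙ Y)) a b ≡ sumℤ (λ l → X l a * (sign l * Y (partner l) b))
    pairing X Y a b = sum-cong (λ l → cong (X l a *_) (Jm-∙ Y l b))

    Similitude : ℤ → IM m → Set
    Similitude c A = A ᵀ ∙ (Jm ∙ A) ≈ (λ a b → c * Jm a b)

    Symplectic : IM m → Set
    Symplectic A = A ᵀ ∙ (Jm ∙ A) ≈ Jm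

    Symplectic⇒Similitude : ∀ A → Symplectic A → Similitude (+ 1) A
    Symplectic⇒Similitude A sp a b = trans (sp a b) (sym (ℤP.*-identityˡ _))

    form-invariant : ∀ Q → Symplectic Q → ∀ N → (Q ∙ N) ᵀ ∙ (Jm ∙ (Q ∙ N)) ≈ N ᵀ ∙ (Jm ∙ N)
    form-invariant Q sp N = begin
      (Q ∙ N) ᵀ ∙ (Jm ∙ (Q ∙ N))      ≈⟨ ∙-cong (ᵀ-∙ Q N) (≈-sym (∙-assoc Jm Q N)) ⟩
      N ᵀ ∙ Q ᵀ ∙ (Jm ∙ Q ∙ N)        ≈⟨ ∙-assoc (N ᵀ) (Q ᵀ) (Jm ∙ Q ∙ N) ⟩
      N ᵀ ∙ (Q ᵀ ∙ (Jm ∙ Q ∙ N))      ≈⟨ ∙-cong (≈-refl {A = N ᵀ}) (≈-sym (∙-assoc (Q ᵀ) (Jm ∙ Q) N)) ⟩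
      N ᵀ ∙ (Q ᵀ ∙ (Jm ∙ Q) ∙ N)      ≈⟨ ∙-cong (≈-refl {A = N ᵀ}) (∙-cong sp (≈-refl {A = N})) ⟩
      N ᵀ ∙ (Jm ∙ N)                  ∎
      where open ≈-Reasoning

    Symplectic-∙ : ∀ X Y → Symplectic X → Symplectic Y → Symplectic (X ∙ Y)
    Symplectic-∙ X Y spX spY = ≈-trans (form-invariant X spX Y) spY

    diag-similitude : ∀ (d : Fin m → ℤ) c → (∀ a → d a * d (partner a) ≡ c) → Similitude c (diag d)
    diag-similitude d c dd≡c a b = begin
      (diag d ᵀ ∙ (Jm ∙ diag d)) a b                         ≡⟨ pairing (diag d) (diag d) a b ⟩
      sumℤ (λ l → d l * δ l a * (sign l * (d (partner l) * δ (partner l) b)))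
        ≡⟨ sum-cong (λ l → reorder (d l) (δ l a) (sign l) (d (partner l)) (δ (partner l) b)) ⟩
      sumℤ (λ l → d l * (sign l * (d (partner l) * δ (partner l) b)) * δ l a)
        ≡⟨ sum-δʳ a (λ l → d l * (sign l * (d (partner l) * δ (partner l) b))) ⟩
      d a * (sign a * (d (partner a) * δ (partner a) b))      ≡⟨ regroup (d a) (sign a) (d (partner a)) (δ (partner a) b) ⟩
      d a * d (partner a) * (sign a * δ (partner a) b)        ≡⟨ cong₂ (λ u v → u * (sign a * v)) (dd≡c a) (δ-sym (partner a) b) ⟩
      c * Jm a b                                              ∎
      where
      open ≡-Reasoning
      reorder : ∀ x e s y f → x * e * (s * (y * f)) ≡ x * (s * (y * f)) * e
      reorder = solve-∀
      regroup : ∀ x s y f → x * (s * (y * f)) ≡ x * y * (s * f)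
      regroup = solve-∀

    -- N lies in the symplectic Lie algebra: Nᵀ Jm + Jm N = 0.
    Hamiltonian : IM m → Set
    Hamiltonian N = ∀ a b → sign a * N (partner a) b + sign (partner b) * N (partner b) a ≡ + 0

    -- N maps everything into a Lagrangian-like subspace: Nᵀ Jm N = 0.
    Isotropic : IM m → Set
    Isotropic N = ∀ a b → sumℤ (λ l → N l a * (sign l * N (partner l) b)) ≡ + 0

    unipotent-pairing : ∀ y (N : IM m) a b → ((I+ y · N) ᵀ ∙ (Jm ∙ (I+ y · N))) a b ≡
      Jm a b + y * (sign a * N (partner a) b + sign (partner b) * N (partner b) a)
             + y * y * sumℤ (λ l → N l a * (sign l * N (partner l) b))
    unipotent-pairing y N a b = begin
      ((I+ y · N) ᵀ ∙ (Jm ∙ (I+ y · N))) a b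
        ≡⟨ pairing (I+ y · N) (I+ y · N) a b ⟩
      sumℤ (λ l → (δ l a + y * N l a) * (sign l * (δ (partner l) b + y * N (partner l) b)))
        ≡⟨ sum-cong (λ l → expand y (δ l a) (N l a) (sign l) (δ (partner l) b) (N (partner l) b)) ⟩
      sumℤ (λ l → f₁ l + (f₂ l + (f₃ l + f₄ l)))
        ≡⟨ trans (sum-+ f₁ _) (cong (_+_ (sumℤ f₁)) (trans (sum-+ f₂ _) (cong (_+_ (sumℤ f₂)) (sum-+ f₃ f₄)))) ⟩
      sumℤ f₁ + (sumℤ f₂ + (sumℤ f₃ + sumℤ f₄))
        ≡⟨ cong₂ _+_ (trans (sum-δʳ a (λ l → sign l * δ (partner l) b)) (cong (sign a *_) (δ-sym (partner a) b)))
             (cong₂ _+_ (trans (sum-*ˡ y (λ l → sign l * N (partner l) b * δ l a)) (cong (y *_) (sum-δʳ a (λ l → sign l * N (partner l) b))))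
               (cong₂ _+_ (trans (sum-cong (λ l → cong (λ d → y * (sign l * N l a * d)) (δ-partnerˡ l b)))
                            (trans (sum-*ˡ y (λ l → sign l * N l a * δ l (partner b))) (cong (y *_) (sum-δʳ (partner b) (λ l → sign l * N l a)))))
                 (sum-*ˡ (y * y) (λ l → N l a * (sign l * N (partner l) b))))) ⟩
      Jm a b + (y * (sign a * N (partner a) b) + (y * (sign (partner b) * N (partner b) a) + y * y * S))
        ≡⟨ collect (Jm a b) y (sign a * N (partner a) b) (sign (partner b) * N (partner b) a) S ⟩
      Jm a b + y * (sign a * N (partner a) b + sign (partner b) * N (partner b) a) + y * y * S ∎
      where
      open ≡-Reasoning
      S : ℤ
      S = sumℤ (λ l → N l a * (sign l * N (partner l) b))
      f₁ f₂ f₃ f₄ : Fin m → ℤ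
      f₁ l = sign l * δ (partner l) b * δ l a
      f₂ l = y * (sign l * N (partner l) b * δ l a)
      f₃ l = y * (sign l * N l a * δ (partner l) b)
      f₄ l = y * y * (N l a * (sign l * N (partner l) b))
      expand : ∀ y d n s e n′ → (d + y * n) * (s * (e + y * n′)) ≡
        s * e * d + (y * (s * n′ * d) + (y * (s * n * e) + y * y * (n * (s * n′))))
      expand = solve-∀
      collect : ∀ j y u v w → j + (y * u + (y * v + y * y * w)) ≡ j + y * (u + v) + y * y * w
      collect = solve-∀

    unipotent-symplectic : ∀ N → Hamiltonian N → Isotropic N → ∀ y → Symplectic (I+ y · N)
    unipotent-symplectic N ham iso y a b = begin
      ((I+ y · N) ᵀ ∙ (Jm ∙ (I+ y · N))) a b    ≡⟨ unipotent-pairing y N a b ⟩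
      Jm a b + y * _ + y * y * _                 ≡⟨ cong₂ (λ u v → Jm a b + y * u + y * y * v) (ham a b) (iso a b) ⟩
      Jm a b + y * + 0 + y * y * + 0             ≡⟨ vanish (Jm a b) y ⟩
      Jm a b                                     ∎
      where
      open ≡-Reasoning
      vanish : ∀ j y → j + y * + 0 + y * y * + 0 ≡ j
      vanish = solve-∀

    δ-partner-self : ∀ i → δ i (partner i) ≡ + 0
    δ-partner-self i = δ-off (λ e → partner-fixfree i (sym e))

    sign-times-partner : ∀ a → sign a * sign (partner a) ≡ - + 1
    sign-times-partner a = begin
      sign a * sign (partner a)   ≡⟨ cong (sign a *_) (sign-partner a) ⟩
      sign a * - sign a           ≡⟨ sym (ℤP.neg-distribʳ-* (sign a) (sign a)) ⟩
      - (sign a * sign a)         ≡⟨ cong -_ (sign-square a) ⟩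
      - + 1                       ∎
      where open ≡-Reasoning

    -- Long root element: the single entry (partner i , i).  I + y·long i is a symplectic transvection.
    long : Fin m → IM m
    long i = 𝐞 (partner i) i

    long-square-zero : ∀ i → SquareZero (long i)
    long-square-zero i a b = begin
      (long i ∙ long i) a b                            ≡⟨ 𝐞-∙ (partner i) i (long i) a b ⟩
      δ a (partner i) * (δ i (partner i) * δ b i)      ≡⟨ cong (λ d → δ a (partner i) * (d * δ b i)) (δ-partner-self i) ⟩
      δ a (partner i) * (+ 0 * δ b i)                  ≡⟨ ℤP.*-zeroʳ (δ a (partner i)) ⟩
      + 0                                              ∎
      where open ≡-Reasoning

    long-hamiltonian : ∀ i → Hamiltonian (long i)
    long-hamiltonian i a b = begin
      sign a * (δ (partner a) (partner i) * δ b i) + sign (partner b) * (δ (partner b) (partner i) * δ a i)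
        ≡⟨ cong₂ (λ u v → sign a * (u * δ b i) + sign (partner b) * (v * δ a i)) (δ-partner a i) (δ-partner b i) ⟩
      sign a * (δ a i * δ b i) + sign (partner b) * (δ b i * δ a i)
        ≡⟨ factor (δ a i) (δ b i) (sign a) (sign (partner b)) ⟩
      δ a i * δ b i * (sign a + sign (partner b))
        ≡⟨ δδ-subst a i b i (λ a b → sign a + sign (partner b)) ⟩
      δ a i * δ b i * (sign i + sign (partner i))
        ≡⟨ cong (λ s → δ a i * δ b i * (sign i + s)) (sign-partner i) ⟩
      δ a i * δ b i * (sign i + - sign i)
        ≡⟨ cancel (δ a i * δ b i) (sign i) ⟩
      + 0 ∎
      where
      open ≡-Reasoning
      factor : ∀ d e s t → s * (d * e) + t * (e * d) ≡ d * e * (s + t)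
      factor = solve-∀
      cancel : ∀ x s → x * (s + - s) ≡ + 0
      cancel = solve-∀

    long-isotropic : ∀ i → Isotropic (long i)
    long-isotropic i a b = begin
      sumℤ (λ l → δ l (partner i) * δ a i * (sign l * long i (partner l) b))
        ≡⟨ sum-cong (λ l → trans (ℤP.*-assoc (δ l (partner i)) (δ a i) _) (cong (_* (δ a i * (sign l * long i (partner l) b))) (δ-sym l (partner i)))) ⟩
      sumℤ (λ l → δ (partner i) l * (δ a i * (sign l * long i (partner l) b)))
        ≡⟨ sum-δ (partner i) (λ l → δ a i * (sign l * long i (partner l) b)) ⟩
      δ a i * (sign (partner i) * (δ (partner (partner i)) (partner i) * δ b i))
        ≡⟨ cong (λ d → δ a i * (sign (partner i) * (d * δ b i))) (trans (δ-partner (partner i) i) (δ-off (partner-fixfree i))) ⟩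
      δ a i * (sign (partner i) * (+ 0 * δ b i))
        ≡⟨ vanish (δ a i) (sign (partner i)) (δ b i) ⟩
      + 0 ∎
      where
      open ≡-Reasoning
      vanish : ∀ x s e → x * (s * (+ 0 * e)) ≡ + 0
      vanish = solve-∀

    long-odd : ∀ i → Odd sign (long i)
    long-odd i a b = begin
      sign a * long i a b * sign b                          ≡⟨ 𝐞-conjugate sign (partner i) i a b ⟩
      sign (partner i) * sign i * long i a b                ≡⟨ cong (_* long i a b) (trans (ℤP.*-comm (sign (partner i)) (sign i)) (sign-times-partner i)) ⟩
      - + 1 * long i a b                                    ≡⟨ ℤP.-1*i≡-i (long i a b) ⟩
      - long i a b                                          ∎
      where open ≡-Reasoning

    -- Short root element: entries (partner i , j) and (partner j , i), with the sign making it Hamiltonian.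
    short : Fin m → Fin m → IM m
    short i j a b = 𝐞 (partner i) j a b + sign i * sign j * 𝐞 (partner j) i a b

    short-∙ : ∀ i j (X : IM m) a b →
      (short i j ∙ X) a b ≡ δ a (partner i) * X j b + sign i * sign j * (δ a (partner j) * X i b)
    short-∙ i j X a b = begin
      sumℤ (λ l → (𝐞 (partner i) j a l + σ * 𝐞 (partner j) i a l) * X l b)
        ≡⟨ sum-cong (λ l → distrib σ (𝐞 (partner i) j a l) (𝐞 (partner j) i a l) (X l b)) ⟩
      sumℤ (λ l → 𝐞 (partner i) j a l * X l b + σ * (𝐞 (partner j) i a l * X l b))
        ≡⟨ sum-+ (λ l → 𝐞 (partner i) j a l * X l b) (λ l → σ * (𝐞 (partner j) i a l * X l b)) ⟩
      (𝐞 (partner i) j ∙ X) a b + sumℤ (λ l → σ * (𝐞 (partner j) i a l * X l b))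
        ≡⟨ cong₂ _+_ (𝐞-∙ (partner i) j X a b) (trans (sum-*ˡ σ (λ l → 𝐞 (partner j) i a l * X l b)) (cong (σ *_) (𝐞-∙ (partner j) i X a b))) ⟩
      δ a (partner i) * X j b + σ * (δ a (partner j) * X i b) ∎
      where
      open ≡-Reasoning
      σ : ℤ
      σ = sign i * sign j
      distrib : ∀ s u v x → (u + s * v) * x ≡ u * x + s * (v * x)
      distrib = solve-∀

    ∙-short : ∀ i j (F : Fin m → ℤ) a →
      sumℤ (λ l → short i j l a * F l) ≡ δ a j * F (partner i) + sign i * sign j * (δ a i * F (partner j))
    ∙-short i j F a = begin
      sumℤ (λ l → (δ l (partner i) * δ a j + σ * (δ l (partner j) * δ a i)) * F l)
        ≡⟨ sum-cong (λ l → trans (distrib σ (δ l (partner i)) (δ a j) (δ l (partner j)) (δ a i) (F l))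
                                 (cong₂ (λ u v → u * (δ a j * F l) + σ * (v * (δ a i * F l))) (δ-sym l (partner i)) (δ-sym l (partner j)))) ⟩
      sumℤ (λ l → δ (partner i) l * (δ a j * F l) + σ * (δ (partner j) l * (δ a i * F l)))
        ≡⟨ sum-+ (λ l → δ (partner i) l * (δ a j * F l)) (λ l → σ * (δ (partner j) l * (δ a i * F l))) ⟩
      sumℤ (λ l → δ (partner i) l * (δ a j * F l)) + sumℤ (λ l → σ * (δ (partner j) l * (δ a i * F l)))
        ≡⟨ cong₂ _+_ (sum-δ (partner i) (λ l → δ a j * F l))
                     (trans (sum-*ˡ σ (λ l → δ (partner j) l * (δ a i * F l))) (cong (σ *_) (sum-δ (partner j) (λ l → δ a i * F l)))) ⟩
      δ a j * F (partner i) + σ * (δ a i * F (partner j)) ∎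
      where
      open ≡-Reasoning
      σ : ℤ
      σ = sign i * sign j
      distrib : ∀ s p e q f x → (p * e + s * (q * f)) * x ≡ p * (e * x) + s * (q * (f * x))
      distrib = solve-∀

    flip : Fin m → Fin m → ℤ
    flip i a = + 1 - + 2 * (δ a i + δ a (partner i))

    private
      flip-value : ∀ {i a x y} → δ a i ≡ x → δ a (partner i) ≡ y → flip i a ≡ + 1 - + 2 * (x + y)
      flip-value a≡ pa≡ = cong₂ (λ x y → + 1 - + 2 * (x + y)) a≡ pa≡

    flip-at : ∀ i → flip i i ≡ - + 1
    flip-at i = flip-value (δ-diag i) (δ-partner-self i)

    flip-at-partner : ∀ i → flip i (partner i) ≡ - + 1
    flip-at-partner i = flip-value (δ-off (partner-fixfree i)) (δ-diag (partner i))

    flip-away : ∀ i a → ¬ a ≡ i → ¬ a ≡ partner i → flip i a ≡ + 1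
    flip-away i a a≢i a≢pi = flip-value (δ-off a≢i) (δ-off a≢pi)

    flip-involutive : ∀ i → Involutive (flip i)
    flip-involutive i a = by-cases (a FP.≟ i) (a FP.≟ partner i)
      where
      by-cases : Dec (a ≡ i) → Dec (a ≡ partner i) → flip i a * flip i a ≡ + 1
      by-cases (yes refl) _ = cong (λ f → f * f) (flip-at i)
      by-cases (no _) (yes refl) = cong (λ f → f * f) (flip-at-partner i)
      by-cases (no a≢i) (no a≢pi) = cong (λ f → f * f) (flip-away i a a≢i a≢pi)

    flip-partner : ∀ i a → flip i (partner a) ≡ flip i a
    flip-partner i a = begin
      + 1 - + 2 * (δ (partner a) i + δ (partner a) (partner i))  ≡⟨ cong₂ (λ x y → + 1 - + 2 * (x + y)) (δ-partnerˡ a i) (δ-partner a i) ⟩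
      + 1 - + 2 * (δ a (partner i) + δ a i)                      ≡⟨ cong (λ x → + 1 - + 2 * x) (ℤP.+-comm (δ a (partner i)) (δ a i)) ⟩
      + 1 - + 2 * (δ a i + δ a (partner i))                      ∎
      where open ≡-Reasoning

    module ShortRoot (i j : Fin m) (j≢i : ¬ j ≡ i) (j≢pi : ¬ j ≡ partner i) where

      private
        σ : ℤ
        σ = sign i * sign j

        i≢pj : ¬ i ≡ partner j
        i≢pj i≡pj = j≢pi (trans (sym (partner-involutive j)) (cong partner (sym i≡pj)))

        zero-row : ∀ x s y → + 0 * x + s * (+ 0 * y) ≡ + 0
        zero-row = solve-∀

        row-i : ∀ b → short i j i b ≡ + 0
        row-i b = trans (cong₂ (λ u v → u * δ b j + σ * (v * δ b i)) (δ-partner-self i) (δ-off i≢pj)) (zero-row (δ b j) σ (δ b i))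

        row-j : ∀ b → short i j j b ≡ + 0
        row-j b = trans (cong₂ (λ u v → u * δ b j + σ * (v * δ b i)) (δ-off j≢pi) (δ-partner-self j)) (zero-row (δ b j) σ (δ b i))

      square-zero : SquareZero (short i j)
      square-zero a b = begin
        (short i j ∙ short i j) a b                                    ≡⟨ short-∙ i j (short i j) a b ⟩
        δ a (partner i) * short i j j b + σ * (δ a (partner j) * short i j i b)
          ≡⟨ cong₂ (λ u v → δ a (partner i) * u + σ * (δ a (partner j) * v)) (row-j b) (row-i b) ⟩
        δ a (partner i) * + 0 + σ * (δ a (partner j) * + 0)            ≡⟨ vanish (δ a (partner i)) σ (δ a (partner j)) ⟩
        + 0                                                            ∎
        where
        open ≡-Reasoning
        vanish : ∀ x s y → x * + 0 + s * (y * + 0) ≡ + 0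
        vanish = solve-∀

      isotropic : Isotropic (short i j)
      isotropic a b = begin
        sumℤ (λ l → short i j l a * (sign l * short i j (partner l) b))
          ≡⟨ ∙-short i j (λ l → sign l * short i j (partner l) b) a ⟩
        δ a j * (sign (partner i) * short i j (partner (partner i)) b) + σ * (δ a i * (sign (partner j) * short i j (partner (partner j)) b))
          ≡⟨ cong₂ (λ u v → δ a j * (sign (partner i) * u) + σ * (δ a i * (sign (partner j) * v)))
                   (trans (cong (λ k → short i j k b) (partner-involutive i)) (row-i b))
                   (trans (cong (λ k → short i j k b) (partner-involutive j)) (row-j b)) ⟩
        δ a j * (sign (partner i) * + 0) + σ * (δ a i * (sign (partner j) * + 0))
          ≡⟨ vanish (δ a j) (sign (partner i)) σ (δ a i) (sign (partner j)) ⟩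
        + 0 ∎
        where
        open ≡-Reasoning
        vanish : ∀ x s t y r → x * (s * + 0) + t * (y * (r * + 0)) ≡ + 0
        vanish = solve-∀

      hamiltonian : Hamiltonian (short i j)
      hamiltonian a b = begin
        sign a * short i j (partner a) b + sign (partner b) * short i j (partner b) a
          ≡⟨ cong₂ _+_ (cong (sign a *_) (row-partner a b)) (cong (sign (partner b) *_) (row-partner b a)) ⟩
        sign a * (δ a i * δ b j + σ * (δ a j * δ b i)) + sign (partner b) * (δ b i * δ a j + σ * (δ b j * δ a i))
          ≡⟨ regroup (sign a) (sign (partner b)) σ (δ a i) (δ b j) (δ a j) (δ b i) ⟩
        δ a i * δ b j * (sign a + σ * sign (partner b)) + δ a j * δ b i * (σ * sign a + sign (partner b))
          ≡⟨ cong₂ _+_ (δδ-subst a i b j (λ a b → sign a + σ * sign (partner b)))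
                       (δδ-subst a j b i (λ a b → σ * sign a + sign (partner b))) ⟩
        δ a i * δ b j * (sign i + σ * sign (partner j)) + δ a j * δ b i * (σ * sign j + sign (partner i))
          ≡⟨ cong₂ (λ u v → δ a i * δ b j * (sign i + σ * u) + δ a j * δ b i * (σ * sign j + v)) (sign-partner j) (sign-partner i) ⟩
        δ a i * δ b j * (sign i + σ * - sign j) + δ a j * δ b i * (σ * sign j + - sign i)
          ≡⟨ expose-square (δ a i * δ b j) (δ a j * δ b i) (sign i) (sign j) ⟩
        δ a i * δ b j * (sign i - sign i * (sign j * sign j)) + δ a j * δ b i * (sign i * (sign j * sign j) - sign i)
          ≡⟨ cong (λ t → δ a i * δ b j * (sign i - sign i * t) + δ a j * δ b i * (sign i * t - sign i)) (sign-square j) ⟩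
        δ a i * δ b j * (sign i - sign i * + 1) + δ a j * δ b i * (sign i * + 1 - sign i)
          ≡⟨ cancel (δ a i * δ b j) (δ a j * δ b i) (sign i) ⟩
        + 0 ∎
        where
        open ≡-Reasoning
        row-partner : ∀ a b → short i j (partner a) b ≡ δ a i * δ b j + σ * (δ a j * δ b i)
        row-partner a b = cong₂ (λ u v → u * δ b j + σ * (v * δ b i)) (δ-partner a i) (δ-partner a j)
        regroup : ∀ s t σ x y u v → s * (x * y + σ * (u * v)) + t * (v * u + σ * (y * x)) ≡ x * y * (s + σ * t) + u * v * (σ * s + t)
        regroup = solve-∀
        expose-square : ∀ p q s t → p * (s + s * t * - t) + q * (s * t * t + - s) ≡ p * (s - s * (t * t)) + q * (s * (t * t) - s)
        expose-square = solve-∀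
        cancel : ∀ p q s → p * (s - s * + 1) + q * (s * + 1 - s) ≡ + 0
        cancel = solve-∀

      odd : Odd (flip i) (short i j)
      odd a b = begin
        flip i a * (𝐞 (partner i) j a b + σ * 𝐞 (partner j) i a b) * flip i b
          ≡⟨ distrib (flip i a) (flip i b) σ (𝐞 (partner i) j a b) (𝐞 (partner j) i a b) ⟩
        flip i a * 𝐞 (partner i) j a b * flip i b + σ * (flip i a * 𝐞 (partner j) i a b * flip i b)
          ≡⟨ cong₂ (λ u v → u + σ * v) (𝐞-conjugate (flip i) (partner i) j a b) (𝐞-conjugate (flip i) (partner j) i a b) ⟩
        flip i (partner i) * flip i j * 𝐞 (partner i) j a b + σ * (flip i (partner j) * flip i i * 𝐞 (partner j) i a b)
          ≡⟨ cong₂ (λ u v → u + σ * v)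
               (cong₂ (λ x y → x * y * 𝐞 (partner i) j a b) (flip-at-partner i) (flip-away i j j≢i j≢pi))
               (cong₂ (λ x y → x * y * 𝐞 (partner j) i a b) (flip-away i (partner j) pj≢i pj≢pi) (flip-at i)) ⟩
        - + 1 * + 1 * 𝐞 (partner i) j a b + σ * (+ 1 * - + 1 * 𝐞 (partner j) i a b)
          ≡⟨ negate σ (𝐞 (partner i) j a b) (𝐞 (partner j) i a b) ⟩
        - (𝐞 (partner i) j a b + σ * 𝐞 (partner j) i a b) ∎
        where
        open ≡-Reasoning
        pj≢i : ¬ partner j ≡ i
        pj≢i pj≡i = i≢pj (sym pj≡i)
        pj≢pi : ¬ partner j ≡ partner i
        pj≢pi pj≡pi = j≢i (partner-injective pj≡pi)
        distrib : ∀ x y s u v → x * (u + s * v) * y ≡ x * u * y + s * (x * v * y)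
        distrib = solve-∀
        negate : ∀ s u v → - + 1 * + 1 * u + s * (+ 1 * - + 1 * v) ≡ - (u + s * v)
        negate = solve-∀

    SymplecticMod : ℤ → IM m → Set
    SymplecticMod q N = N ᵀ ∙ (Jm ∙ N) ≋ Jm mod q

    -- The mod-2 shadow of `Hamiltonian`: U (partner a) b ≡ U (partner b) a (mod 2).
    SymmetricMod2 : IM m → Set
    SymmetricMod2 U = ∀ a b → + 2 ∣ U (partner a) b - U (partner b) a

    expansion-symmetric : ∀ n (N U : IM m) → Expansion (suc n) N U → SymplecticMod (2^ suc (suc n)) N → SymmetricMod2 U
    expansion-symmetric n N U e sp a b =
      subst (+ 2 ∣_) (signs-removed (sign a) (sign (partner b)) (U (partner a) b) (U (partner b) a))
        (∣m∣n⇒∣m-n (∣m∣n⇒∣m-n (∣m∣n⇒∣m-n 2∣h (unit-parity (sign-unit a) (U (partner a) b)))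
                                             (unit-parity (sign-unit (partner b)) (U (partner b) a)))
                   (divides (U (partner b) a) refl))
      where
      Q h S : ℤ
      Q = 2^ suc n
      h = sign a * U (partner a) b + sign (partner b) * U (partner b) a
      S = sumℤ (λ l → U l a * (sign l * U (partner l) b))
      approx : (I+ Q · U) ᵀ ∙ (Jm ∙ (I+ Q · U)) ≋ Jm mod 2^ suc (suc n)
      approx = ≋-trans (∙-≋ (ᵀ-≋ (≋-sym e)) (∙-≋ (≋-refl {A = Jm}) (≋-sym e))) sp
      drop-J : ∀ j x y → j + x + y - j ≡ x + y
      drop-J = solve-∀
      2^Q∣Qh+QQS : 2^ suc (suc n) ∣ Q * h + Q * Q * S
      2^Q∣Qh+QQS = subst (2^ suc (suc n) ∣_) (trans (cong (_- Jm a b) (unipotent-pairing Q U a b)) (drop-J (Jm a b) (Q * h) (Q * Q * S)))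
                     (entry approx a b)
      2Q∣Qh : Q * + 2 ∣ Q * h
      2Q∣Qh = subst (_∣ Q * h) (trans (2^-suc (suc n)) (ℤP.*-comm (+ 2) Q))
                (∣m+n∣n⇒∣m 2^Q∣Qh+QQS (∣m⇒∣m*n S (2^-∣-square n)))
      2∣h : + 2 ∣ h
      2∣h = *-cancelˡ-∣ Q {{ℕP.m^n≢0 2 (suc n)}} 2Q∣Qh
      signs-removed : ∀ s t u v → s * u + t * v - (s * u - u) - (t * v - v) - v * + 2 ≡ u - v
      signs-removed = solve-∀

    -- The 2×2 block on the hyperbolic pair (i , partner i): its Lie algebra sl₂ contains the
    -- long roots of i and partner i, and their commutator yields the Cartan direction.
    module Cartan (i : Fin m) where

      pair : Fin 2 → Fin m
      pair zero = i
      pair (suc zero) = partner i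

      pair-δ : ∀ r s → δ (pair r) (pair s) ≡ δ r s
      pair-δ zero zero = δ-diag i
      pair-δ zero (suc zero) = δ-partner-self i
      pair-δ (suc zero) zero = δ-off (partner-fixfree i)
      pair-δ (suc zero) (suc zero) = δ-diag (partner i)

      open Block pair pair-δ public

      block-mat2 : ∀ a b c d x y → block (mat2 a b c d) x y ≡
        δ x i * (a * δ y i + b * δ y (partner i)) + δ x (partner i) * (c * δ y i + d * δ y (partner i))
      block-mat2 a b c d x y = expand a b c d (δ x i) (δ x (partner i)) (δ y i) (δ y (partner i))
        where
        expand : ∀ a b c d x₀ x₁ y₀ y₁ → x₀ * a * y₀ + (x₀ * b * y₁ + + 0) + (x₁ * c * y₀ + (x₁ * d * y₁ + + 0) + + 0) ≡
          x₀ * (a * y₀ + b * y₁) + x₁ * (c * y₀ + d * y₁)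
        expand = solve-∀

      block-step : ∀ a b c d a′ b′ c′ d′ {p q r s} →
        a + a′ + (a * a′ + b * c′) ≡ p → b + b′ + (a * b′ + b * d′) ≡ q →
        c + c′ + (c * a′ + d * c′) ≡ r → d + d′ + (c * b′ + d * d′) ≡ s →
        (1+ block (mat2 a b c d)) ∙ (1+ block (mat2 a′ b′ c′ d′)) ≈ 1+ block (mat2 p q r s)
      block-step a b c d a′ b′ c′ d′ p≡ q≡ r≡ s≡ =
        ≈-trans (1+block-∙ (mat2 a b c d) (mat2 a′ b′ c′ d′))
                (1+-cong (block-cong (≈-trans (mat2-⊛ a b c d a′ b′ c′ d′) (mat2-cong p≡ q≡ r≡ s≡))))

      lower-block : ∀ y → I+ y · long i ≈ 1+ block (mat2 (+ 0) (+ 0) y (+ 0))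
      lower-block y a b = cong (_+_ (δ a b)) (sym (trans (block-mat2 (+ 0) (+ 0) y (+ 0) a b)
        (only-lower y (δ a i) (δ a (partner i)) (δ b i) (δ b (partner i)))))
        where
        only-lower : ∀ y x₀ x₁ y₀ y₁ → x₀ * (+ 0 * y₀ + + 0 * y₁) + x₁ * (y * y₀ + + 0 * y₁) ≡ y * (x₁ * y₀)
        only-lower = solve-∀

      upper-block : ∀ y → I+ y · long (partner i) ≈ 1+ block (mat2 (+ 0) y (+ 0) (+ 0))
      upper-block y a b = cong (_+_ (δ a b)) (trans (cong (λ k → y * (δ a k * δ b (partner i))) (partner-involutive i))
        (sym (trans (block-mat2 (+ 0) y (+ 0) (+ 0) a b)
          (only-upper y (δ a i) (δ a (partner i)) (δ b i) (δ b (partner i))))))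
        where
        only-upper : ∀ y x₀ x₁ y₀ y₁ → x₀ * (+ 0 * y₀ + y * y₁) + x₁ * (+ 0 * y₀ + + 0 * y₁) ≡ y * (x₀ * y₁)
        only-upper = solve-∀

      commutator : ℤ → IM m
      commutator y = (I+ y · long i) ∙ ((I+ + 2 · long (partner i)) ∙ ((I+ (- y) · long i) ∙ (I+ (- + 2) · long (partner i))))

      commutator-block : ∀ y → commutator y ≈ 1+ block (mat2 (- (+ 2 * y)) (+ 4 * y) (- (+ 2 * y * y)) (+ 2 * y + + 4 * y * y))
      commutator-block y = begin
        commutator y
          ≈⟨ ∙-cong (lower-block y) (∙-cong (upper-block (+ 2)) (∙-cong (lower-block (- y)) (upper-block (- + 2)))) ⟩
        (1+ block (mat2 (+ 0) (+ 0) y (+ 0))) ∙ ((1+ block (mat2 (+ 0) (+ 2) (+ 0) (+ 0))) ∙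
          ((1+ block (mat2 (+ 0) (+ 0) (- y) (+ 0))) ∙ (1+ block (mat2 (+ 0) (- + 2) (+ 0) (+ 0)))))
          ≈⟨ ∙-cong (≈-refl {A = 1+ block (mat2 (+ 0) (+ 0) y (+ 0))}) (∙-cong (≈-refl {A = 1+ block (mat2 (+ 0) (+ 2) (+ 0) (+ 0))})
               (block-step (+ 0) (+ 0) (- y) (+ 0) (+ 0) (- + 2) (+ 0) (+ 0) refl (e₁ y) (e₀ y) (e₂ y))) ⟩
        (1+ block (mat2 (+ 0) (+ 0) y (+ 0))) ∙ ((1+ block (mat2 (+ 0) (+ 2) (+ 0) (+ 0))) ∙ (1+ block (mat2 (+ 0) (- + 2) (- y) (+ 2 * y))))
          ≈⟨ ∙-cong (≈-refl {A = 1+ block (mat2 (+ 0) (+ 0) y (+ 0))})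
               (block-step (+ 0) (+ 2) (+ 0) (+ 0) (+ 0) (- + 2) (- y) (+ 2 * y) (e₃ y) (e₄ y) (e₅ y) (e₆ y)) ⟩
        (1+ block (mat2 (+ 0) (+ 0) y (+ 0))) ∙ (1+ block (mat2 (- (+ 2 * y)) (+ 4 * y) (- y) (+ 2 * y)))
          ≈⟨ block-step (+ 0) (+ 0) y (+ 0) (- (+ 2 * y)) (+ 4 * y) (- y) (+ 2 * y) (e₇ y) (e₈ y) (e₉ y) (e₁₀ y) ⟩
        1+ block (mat2 (- (+ 2 * y)) (+ 4 * y) (- (+ 2 * y * y)) (+ 2 * y + + 4 * y * y)) ∎
        where
        open ≈-Reasoning
        e₀ : ∀ y → - y + + 0 + (- y * + 0 + + 0 * + 0) ≡ - y
        e₀ = solve-∀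
        e₁ : ∀ y → + 0 + - + 2 + (+ 0 * - + 2 + + 0 * + 0) ≡ - + 2
        e₁ = solve-∀
        e₂ : ∀ y → + 0 + + 0 + (- y * - + 2 + + 0 * + 0) ≡ + 2 * y
        e₂ = solve-∀
        e₃ : ∀ y → + 0 + + 0 + (+ 0 * + 0 + + 2 * - y) ≡ - (+ 2 * y)
        e₃ = solve-∀
        e₄ : ∀ y → + 2 + - + 2 + (+ 0 * - + 2 + + 2 * (+ 2 * y)) ≡ + 4 * y
        e₄ = solve-∀
        e₅ : ∀ y → + 0 + - y + (+ 0 * + 0 + + 0 * - y) ≡ - y
        e₅ = solve-∀
        e₆ : ∀ y → + 0 + + 2 * y + (+ 0 * - + 2 + + 0 * (+ 2 * y)) ≡ + 2 * y
        e₆ = solve-∀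
        e₇ : ∀ y → + 0 + - (+ 2 * y) + (+ 0 * - (+ 2 * y) + + 0 * - y) ≡ - (+ 2 * y)
        e₇ = solve-∀
        e₈ : ∀ y → + 0 + + 4 * y + (+ 0 * (+ 4 * y) + + 0 * (+ 2 * y)) ≡ + 4 * y
        e₈ = solve-∀
        e₉ : ∀ y → y + - y + (y * - (+ 2 * y) + + 0 * - y) ≡ - (+ 2 * y * y)
        e₉ = solve-∀
        e₁₀ : ∀ y → + 0 + + 2 * y + (y * (+ 4 * y) + + 0 * (+ 2 * y)) ≡ + 2 * y + + 4 * y * y
        e₁₀ = solve-∀

      cartan : ℤ → IM m
      cartan x a b = x * 𝐞 (partner i) (partner i) a b + - x * 𝐞 i i a b

      block-mat2-∣ : ∀ {q a b c d} → q ∣ a → q ∣ b → q ∣ c → q ∣ d → ∀ x y → q ∣ block (mat2 a b c d) x y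
      block-mat2-∣ {q} {a} {b} {c} {d} q∣a q∣b q∣c q∣d x y = subst (q ∣_) (sym (block-mat2 a b c d x y))
        (∣m∣n⇒∣m+n (∣n⇒∣m*n (δ x i) (∣m∣n⇒∣m+n (∣m⇒∣m*n (δ y i) q∣a) (∣m⇒∣m*n (δ y (partner i)) q∣b)))
                   (∣n⇒∣m*n (δ x (partner i)) (∣m∣n⇒∣m+n (∣m⇒∣m*n (δ y i) q∣c) (∣m⇒∣m*n (δ y (partner i)) q∣d))))

      commutator-minus-cartan : ∀ y n x a b → commutator y a b - (δ a b + n * cartan x a b) ≡
        block (mat2 (- (+ 2 * y) + n * x) (+ 4 * y) (- (+ 2 * y * y)) (+ 2 * y + + 4 * y * y - n * x)) a b
      commutator-minus-cartan y n x a b = begin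
        commutator y a b - (δ a b + n * cartan x a b)
          ≡⟨ cong (_- (δ a b + n * cartan x a b)) (trans (commutator-block y a b) (cong (_+_ (δ a b)) (block-mat2 _ _ _ _ a b))) ⟩
        δ a b + (δ a i * (K₀₀ * δ b i + K₀₁ * δ b (partner i)) + δ a (partner i) * (K₁₀ * δ b i + K₁₁ * δ b (partner i)))
          - (δ a b + n * cartan x a b)
          ≡⟨ regroup (δ a b) n x K₀₀ K₀₁ K₁₀ K₁₁ (δ a i) (δ a (partner i)) (δ b i) (δ b (partner i)) ⟩
        δ a i * ((K₀₀ + n * x) * δ b i + K₀₁ * δ b (partner i)) + δ a (partner i) * (K₁₀ * δ b i + (K₁₁ - n * x) * δ b (partner i))
          ≡⟨ sym (block-mat2 _ _ _ _ a b) ⟩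
        block (mat2 (K₀₀ + n * x) K₀₁ K₁₀ (K₁₁ - n * x)) a b ∎
        where
        open ≡-Reasoning
        K₀₀ K₀₁ K₁₀ K₁₁ : ℤ
        K₀₀ = - (+ 2 * y)
        K₀₁ = + 4 * y
        K₁₀ = - (+ 2 * y * y)
        K₁₁ = + 2 * y + + 4 * y * y
        regroup : ∀ d n x k₀₀ k₀₁ k₁₀ k₁₁ x₀ x₁ y₀ y₁ →
          d + (x₀ * (k₀₀ * y₀ + k₀₁ * y₁) + x₁ * (k₁₀ * y₀ + k₁₁ * y₁)) - (d + n * (x * (x₁ * y₁) + - x * (x₀ * y₀))) ≡
          x₀ * ((k₀₀ + n * x) * y₀ + k₀₁ * y₁) + x₁ * (k₁₀ * y₀ + (k₁₁ - n * x) * y₁)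
        regroup = solve-∀

      -- For y = 2^{t+1} x and n = 2^{t+2} the four entries are divisible by 2^{t+3} = 8·2^t.
      private
        pow₁ : ∀ t → 2^ suc t ≡ + 2 * 2^ t
        pow₁ = 2^-suc
        pow₂ : ∀ t → 2^ suc (suc t) ≡ + 4 * 2^ t
        pow₂ t = trans (2^-suc (suc t)) (trans (cong (+ 2 *_) (pow₁ t)) (sym (ℤP.*-assoc (+ 2) (+ 2) (2^ t))))
        pow₃ : ∀ t → 2^ suc (suc (suc t)) ≡ + 8 * 2^ t
        pow₃ t = trans (2^-suc (suc (suc t))) (trans (cong (+ 2 *_) (pow₂ t)) (sym (ℤP.*-assoc (+ 2) (+ 4) (2^ t))))
        by-8·2^t : ∀ t {lhs} q → lhs ≡ q * (+ 8 * 2^ t) → 2^ suc (suc (suc t)) ∣ lhs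
        by-8·2^t t q eq = divides q (trans eq (cong (q *_) (sym (pow₃ t))))

        entry₀₀ : ∀ t x → 2^ suc (suc (suc t)) ∣ - (+ 2 * (2^ suc t * x)) + 2^ suc (suc t) * x
        entry₀₀ t x = by-8·2^t t (+ 0) (trans (cong₂ (λ u v → - (+ 2 * (u * x)) + v * x) (pow₁ t) (pow₂ t)) (vanish (2^ t) x))
          where
          vanish : ∀ p x → - (+ 2 * (+ 2 * p * x)) + + 4 * p * x ≡ + 0 * (+ 8 * p)
          vanish = solve-∀

        entry₀₁ : ∀ t x → 2^ suc (suc (suc t)) ∣ + 4 * (2^ suc t * x)
        entry₀₁ t x = by-8·2^t t x (trans (cong (λ u → + 4 * (u * x)) (pow₁ t)) (factor (2^ t) x))
          where
          factor : ∀ p x → + 4 * (+ 2 * p * x) ≡ x * (+ 8 * p)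
          factor = solve-∀

        entry₁₀ : ∀ t x → 2^ suc (suc (suc t)) ∣ - (+ 2 * (2^ suc t * x) * (2^ suc t * x))
        entry₁₀ t x = by-8·2^t t (- (2^ t * x * x)) (trans (cong (λ u → - (+ 2 * (u * x) * (u * x))) (pow₁ t)) (factor (2^ t) x))
          where
          factor : ∀ p x → - (+ 2 * (+ 2 * p * x) * (+ 2 * p * x)) ≡ - (p * x * x) * (+ 8 * p)
          factor = solve-∀

        entry₁₁ : ∀ t x → 2^ suc (suc (suc t)) ∣ + 2 * (2^ suc t * x) + + 4 * (2^ suc t * x) * (2^ suc t * x) - 2^ suc (suc t) * x
        entry₁₁ t x = by-8·2^t t (+ 2 * 2^ t * x * x)
          (trans (cong₂ (λ u v → + 2 * (u * x) + + 4 * (u * x) * (u * x) - v * x) (pow₁ t) (pow₂ t)) (factor (2^ t) x))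
          where
          factor : ∀ p x → + 2 * (+ 2 * p * x) + + 4 * (+ 2 * p * x) * (+ 2 * p * x) - + 4 * p * x ≡ + 2 * p * x * x * (+ 8 * p)
          factor = solve-∀

      commutator-expansion : ∀ t x → Expansion (suc (suc t)) (commutator (2^ suc t * x)) (cartan x)
      commutator-expansion t x = entrywise λ a b →
        subst (2^ suc (suc (suc t)) ∣_) (sym (commutator-minus-cartan (2^ suc t * x) (2^ suc (suc t)) x a b))
          (block-mat2-∣ (entry₀₀ t x) (entry₀₁ t x) (entry₁₀ t x) (entry₁₁ t x) a b)

    level-J : ∀ k → level k (J g) ≈ Jm
    level-J k i j = J-entry i j k

    const-GSp : ∀ {c} A → c ≡ + 1 ⊎ c ≡ - + 1 → Similitude c A → IsGSp g (const A)
    const-GSp {c} A c=±1 sim = (λ i j n → constant (A i j) n) , (λ _ → c) , (λ n → constant c n) , unit c=±1 , equation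
      where
      constant : ∀ x n → ModEq n (λ _ → x) (λ _ → x)
      constant x n = ∣⇒∣ᵤ {k = 2^ n} (divides (+ 0) (ℤP.+-inverseʳ x))
      unit : c ≡ + 1 ⊎ c ≡ - + 1 → IsUnit (λ _ → c)
      unit (inj₁ refl) 2∣1 with ℕD.∣1⇒≡1 2∣1
      ... | ()
      unit (inj₂ refl) 2∣1 with ℕD.∣1⇒≡1 2∣1
      ... | ()
      equation : EqMat (transpose (const A) ⊗ (J g ⊗ const A)) (scal (λ _ → c) (J g))
      equation k = ≋⇒CongMat k (transpose (const A) ⊗ (J g ⊗ const A)) (scal (λ _ → c) (J g)) (≈⇒≋ at-level)
        where
        at-level : level k (transpose (const A) ⊗ (J g ⊗ const A)) ≈ level k (scal (λ _ → c) (J g))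
        at-level a b = trans (∙-cong (≈-refl {A = A ᵀ}) (∙-cong (level-J k) (≈-refl {A = A})) a b)
                             (trans (sim a b) (cong (c *_) (sym (level-J k a b))))

    IsSp⇒SymplecticMod : ∀ M → IsSp g M → ∀ k → SymplecticMod (2^ k) (level k M)
    IsSp⇒SymplecticMod M (_ , M-symplectic) k =
      ≋-trans (≈⇒≋ (∙-cong (≈-refl {A = level k M ᵀ}) (∙-cong (≈-sym (level-J k)) (≈-refl {A = level k M}))))
        (≋-trans (CongMat⇒≋ k (transpose M ⊗ (J g ⊗ M)) (J g) (M-symplectic k)) (≈⇒≋ (level-J k)))

    module Commutators (H : Mat m → Set) (H-subgroup : IsSubgroupGSp g H) (H-full : FullPreimage g H) where

      const∈H : ∀ {c} A → c ≡ + 1 ⊎ c ≡ - + 1 → Similitude c A → A ≋ δ mod + 2 → H (const A)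
      const∈H A c=±1 sim A≡I = H-full idM (const A) (IsSubgroupGSp.id∈ H-subgroup) (const-GSp A c=±1 sim)
        (≋⇒CongMat 1 idM (const A) (≋-sym A≡I))

      unipotent∈H : ∀ N → Hamiltonian N → Isotropic N → ∀ y → + 2 ∣ y → H (const (I+ y · N))
      unipotent∈H N ham iso y 2∣y = const∈H (I+ y · N) (inj₁ refl) (Symplectic⇒Similitude (I+ y · N) (unipotent-symplectic N ham iso y))
        (entrywise λ a b → subst (+ 2 ∣_) (sym (drop-δ (δ a b) (y * N a b))) (∣m⇒∣m*n (N a b) 2∣y))
        where
        drop-δ : ∀ d z → d + z - d ≡ z
        drop-δ = solve-∀

      diag∈H : ∀ d {c} → c ≡ + 1 ⊎ c ≡ - + 1 → (∀ a → d a * d (partner a) ≡ c) → (∀ a → + 2 ∣ d a - + 1) → H (const (diag d))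
      diag∈H d c=±1 dd≡c d-odd = const∈H (diag d) c=±1 (diag-similitude d _ dd≡c)
        (entrywise λ a b → subst (+ 2 ∣_) (factor (d a) (δ a b)) (∣m⇒∣m*n (δ a b) (d-odd a)))
        where
        factor : ∀ x e → (x - + 1) * e ≡ x * e - e
        factor = solve-∀

      Reach : ℕ → IM m → Set
      Reach k R = Σ (Mat m) λ C → CommSub H C × level k C ≋ R mod 2^ k

      reach-δ : ∀ k → Reach k δ
      reach-δ k = idM , c-id , ≋-refl

      reach-≋ : ∀ {k R R′} → Reach k R → R ≋ R′ mod 2^ k → Reach k R′
      reach-≋ (C , C∈ , C≡R) R≡R′ = C , C∈ , ≋-trans C≡R R≡R′

      reach-commutator : ∀ {k} R → Reach k R → ∀ A A′ B B′ → H (const A) → H (const A′) → H (const B) → H (const B′) →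
        A ∙ A′ ≈ δ → B ∙ B′ ≈ δ → Reach k (R ∙ (A ∙ (B ∙ (A′ ∙ B′))))
      reach-commutator R (C , C∈ , C≡R) A A′ B B′ A∈ A′∈ B∈ B′∈ AA′≈δ BB′≈δ =
        C ⊗ (const A ⊗ (const B ⊗ (const A′ ⊗ const B′))) ,
        c-step C∈ A∈ A′∈ B∈ B′∈ (≈⇒EqMat (A ∙ A′) δ AA′≈δ) (≈⇒EqMat (B ∙ B′) δ BB′≈δ) ,
        ∙-≋ C≡R ≋-refl

      reach⇒closure : ∀ M → (∀ k → Reach k (level k M)) → InClosureComm H M
      reach⇒closure M reach k = C , C∈[H,H] , ≋⇒CongMat k C M C≡M
        where
        open Σ (reach k) renaming (proj₁ to C; proj₂ to C-data)
        open Σ C-data renaming (proj₁ to C∈[H,H]; proj₂ to C≡M)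


      -- A move at level n: a commutator [A, B] of elements of H, and a symplectic Q inverting it
      -- whose first-order term at level n is W.  Multiplying the error term by Q changes its
      -- first-order term by W.
      record Move (n : ℕ) : Set where
        field
          A A′ B B′ Q W : IM m
          A∈H : H (const A)
          A′∈H : H (const A′)
          B∈H : H (const B)
          B′∈H : H (const B′)
          A-inverse : A ∙ A′ ≈ δ
          B-inverse : B ∙ B′ ≈ δ
          inverts : (A ∙ (B ∙ (A′ ∙ B′))) ∙ Q ≈ δ
          Q-symplectic : Symplectic Q
          Q-expansion : Expansion n Q W

      private
        2∣2^suc : ∀ t x → + 2 ∣ 2^ suc t * x
        2∣2^suc t x = ∣m⇒∣m*n x (divides (2^ t) (trans (2^-suc t) (ℤP.*-comm (+ 2) (2^ t))))

        doubled : ∀ t x → - (2^ suc t * x) + - (2^ suc t * x) + 2^ suc (suc t) * x ≡ + 0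
        doubled t x = trans (cong (λ p → - (2^ suc t * x) + - (2^ suc t * x) + p * x) (2^-suc (suc t))) (cancel (2^ suc t) x)
          where
          cancel : ∀ p x → - (p * x) + - (p * x) + + 2 * p * x ≡ + 0
          cancel = solve-∀

      -- Moves from a sign diagonal d ∈ H: [d, I + y·N] = I − 2y·N for N odd under d.
      sign-move : ∀ t (d : Fin m → ℤ) (N : IM m) → H (const (diag d)) → Involutive d → Odd d N → SquareZero N →
        Hamiltonian N → Isotropic N → ∀ x → Move (suc (suc t))
      sign-move t d N d∈H d²≡1 odd N²≡0 ham iso x = record
        { A = diag d ; A′ = diag d ; B = I+ y · N ; B′ = I+ (- y) · N
        ; Q = I+ (2^ suc (suc t) * x) · N ; W = λ a b → x * N a b
        ; A∈H = d∈H ; A′∈H = d∈H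
        ; B∈H = unipotent∈H N ham iso y (2∣2^suc t x)
        ; B′∈H = unipotent∈H N ham iso (- y) (∣m⇒∣-m (2∣2^suc t x))
        ; A-inverse = diag-involutive {d = d} d²≡1
        ; B-inverse = unipotent-inverse {N = N} N²≡0 y
        ; inverts = ≈-trans (∙-cong (sign-commutator {d = d} {N} d²≡1 odd N²≡0 y) ≈-refl)
                    (≈-trans (unipotent-∙ {N = N} N²≡0 (- y + - y) (2^ suc (suc t) * x))
                             (≈-trans (unipotent-cong N (doubled t x)) (unipotent-zero N)))
        ; Q-symplectic = unipotent-symplectic N ham iso (2^ suc (suc t) * x)
        ; Q-expansion = ≈⇒≋ (λ a b → cong (_+_ (δ a b)) (ℤP.*-assoc (2^ suc (suc t)) x (N a b)))
        }
        where
        y : ℤ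
        y = 2^ suc t * x

      -- The ±1 diagonals used by the moves lie in H: diag(sign) = diag(I, −I) with multiplier −1,
      -- and the flips with multiplier 1.
      private
        sign-odd : ∀ a → + 2 ∣ sign a - + 1
        sign-odd a = subst (λ s → + 2 ∣ s - + 1) (ℤP.*-identityʳ (sign a)) (unit-parity (sign-unit a) (+ 1))

        diag-sign∈H : H (const (diag sign))
        diag-sign∈H = diag∈H sign (inj₂ refl) sign-times-partner sign-odd

        flip∈H : ∀ i → H (const (diag (flip i)))
        flip∈H i = diag∈H (flip i) (inj₁ refl) (λ a → trans (cong (flip i a *_) (flip-partner i a)) (flip-involutive i a))
          (λ a → divides (- (δ a i + δ a (partner i))) (even (δ a i + δ a (partner i))))
          where
          even : ∀ s → + 1 - + 2 * s - + 1 ≡ - s * + 2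
          even = solve-∀

      -- Long root: clears the entry (partner i , i), via the sign diagonal (a similitude with multiplier −1).
      long-move : ∀ t i x → Move (suc (suc t))
      long-move t i x = sign-move t sign (long i) diag-sign∈H sign-square (long-odd i) (long-square-zero i)
        (long-hamiltonian i) (long-isotropic i) x

      -- Short root: clears the entries (partner i , j) and (partner j , i), via the flip at i.
      short-move : ∀ t i j → ¬ j ≡ i → ¬ j ≡ partner i → ∀ x → Move (suc (suc t))
      short-move t i j j≢i j≢pi x = sign-move t (flip i) (short i j) (flip∈H i) (flip-involutive i) odd square-zero
        hamiltonian isotropic x
        where open ShortRoot i j j≢i j≢pi

      -- Cartan direction: clears the diagonal entries (i , i) and (partner i , partner i), via the
      -- commutator of the two opposite long roots of the pair (i , partner i).
      cartan-move : ∀ t i x → Move (suc (suc t))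
      cartan-move t i x = record
        { A = I+ (+ 2) · long (partner i) ; A′ = I+ (- + 2) · long (partner i)
        ; B = I+ y · long i ; B′ = I+ (- y) · long i
        ; Q = commutator y ; W = cartan x
        ; A∈H = transvection∈H (partner i) (+ 2) (divides (+ 1) refl)
        ; A′∈H = transvection∈H (partner i) (- + 2) (divides (- + 1) refl)
        ; B∈H = transvection∈H i y (2∣2^suc t x)
        ; B′∈H = transvection∈H i (- y) (∣m⇒∣-m (2∣2^suc t x))
        ; A-inverse = unipotent-inverse {N = long (partner i)} (long-square-zero (partner i)) (+ 2)
        ; B-inverse = unipotent-inverse {N = long i} (long-square-zero i) y
        ; inverts = commutator-inverse (I+ (+ 2) · long (partner i)) (I+ (- + 2) · long (partner i)) (I+ y · long i) (I+ (- y) · long i)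
            (unipotent-inverse {N = long (partner i)} (long-square-zero (partner i)) (+ 2))
            (unipotent-inverse′ {N = long (partner i)} (long-square-zero (partner i)) (+ 2))
            (unipotent-inverse {N = long i} (long-square-zero i) y)
            (unipotent-inverse′ {N = long i} (long-square-zero i) y)
        ; Q-symplectic = Symplectic-∙ (I+ y · long i) _ (transvection-Sp i y)
            (Symplectic-∙ (I+ (+ 2) · long (partner i)) _ (transvection-Sp (partner i) (+ 2))
              (Symplectic-∙ (I+ (- y) · long i) (I+ (- + 2) · long (partner i)) (transvection-Sp i (- y)) (transvection-Sp (partner i) (- + 2))))
        ; Q-expansion = commutator-expansion t x
        }
        where
        open Cartan i
        y : ℤ
        y = 2^ suc t * x
        transvection-Sp : ∀ k c → Symplectic (I+ c · long k)
        transvection-Sp k = unipotent-symplectic (long k) (long-hamiltonian k) (long-isotropic k)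
        transvection∈H : ∀ k c → + 2 ∣ c → H (const (I+ c · long k))
        transvection∈H k = unipotent∈H (long k) (long-hamiltonian k) (long-isotropic k)

      record Clearing (n : ℕ) (U : IM m) (i j : Fin m) : Set where
        field
          move : Move n
          settles : Settles U (Move.W move)
          clears : + 2 ∣ Move.W move (partner i) j + U (partner i) j

      private
        twice : ∀ x → + 2 ∣ x + x
        twice x = divides x (double x)
          where
          double : ∀ x → x + x ≡ x * + 2
          double = solve-∀

      clear-long : ∀ t (U : IM m) i → Clearing (suc (suc t)) U i i
      clear-long t U i = record
        { move = long-move t i x
        ; settles = settles-single U (partner i) i x (twice x)
        ; clears = subst (λ w → + 2 ∣ w + x) (sym (single-at (partner i) i x)) (twice x) }
        where
        x : ℤ
        x = U (partner i) i
      clear-cartan : ∀ t (U : IM m) → SymmetricMod2 U → ∀ i → Clearing (suc (suc t)) U i (partner i)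
      clear-cartan t U symmetric i = record
        { move = cartan-move t i x
        ; settles = settles-pair U (partner i) (partner i) i i x (- x) distinct (twice x) diagonal
        ; clears = subst (λ w → + 2 ∣ w + x) (sym (pair-at x (- x) distinct)) (twice x) }
        where
        x : ℤ
        x = U (partner i) (partner i)
        distinct : ¬ (partner i ≡ i × partner i ≡ i)
        distinct (pi≡i , _) = partner-fixfree i pi≡i
        -- U (i , i) ≡ U (partner i , partner i) (mod 2)
        diagonal : + 2 ∣ - x + U i i
        diagonal = subst (+ 2 ∣_) (negate x (U i i))
          (∣m⇒∣-m (subst (λ k → + 2 ∣ x - U k i) (partner-involutive i) (symmetric i (partner i))))
          where
          negate : ∀ x u → - (x - u) ≡ - x + u
          negate = solve-∀
      clear-short : ∀ t (U : IM m) → SymmetricMod2 U → ∀ i j → ¬ j ≡ i → ¬ j ≡ partner i → Clearing (suc (suc t)) U i j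
      clear-short t U symmetric i j j≢i j≢pi = record
        { move = short-move t i j j≢i j≢pi x
        ; settles = settles-≈ {W = λ a b → x * short i j a b} two-entries
            (settles-pair U (partner i) j (partner j) i x (x * σ) distinct (twice x) partner-entry)
        ; clears = subst (λ w → + 2 ∣ w + x) (sym (trans (two-entries (partner i) j) (pair-at x (x * σ) distinct))) (twice x) }
        where
        x : ℤ
        x = U (partner i) j
        σ : ℤ
        σ = sign i * sign j
        two-entries : (λ a b → x * short i j a b) ≈ (λ a b → x * 𝐞 (partner i) j a b + x * σ * 𝐞 (partner j) i a b)
        two-entries a b = distrib x σ (𝐞 (partner i) j a b) (𝐞 (partner j) i a b)
          where
          distrib : ∀ x s u v → x * (u + s * v) ≡ x * u + x * s * v
          distrib = solve-∀
        distinct : ¬ (partner i ≡ partner j × j ≡ i)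
        distinct (_ , j≡i) = j≢i j≡i
        -- x σ + U (partner j , i) ≡ x + U (partner i , j) ≡ 0 (mod 2)
        partner-entry : + 2 ∣ x * σ + U (partner j) i
        partner-entry = subst (+ 2 ∣_) (regroup x (sign i) (sign j) (U (partner j) i))
          (∣m∣n⇒∣m+n (∣m∣n⇒∣m+n (∣m∣n⇒∣m+n (unit-parity (sign-unit i) (sign j * x)) (unit-parity (sign-unit j) x)) (symmetric j i)) (twice x))
          where
          regroup : ∀ x s t u → s * (t * x) - t * x + (t * x - x) + (u - x) + (x + x) ≡ x * (s * t) + u
          regroup = solve-∀

      clearing : ∀ t (U : IM m) → SymmetricMod2 U → ∀ i j → Clearing (suc (suc t)) U i j
      clearing t U symmetric i j with j FP.≟ i | j FP.≟ partner i
      ... | yes refl | _ = clear-long t U i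
      ... | no _ | yes refl = clear-cartan t U symmetric i
      ... | no j≢i | no j≢pi = clear-short t U symmetric i j j≢i j≢pi

      module Elimination (k : ℕ) (M : IM m) where

        record Stage (n : ℕ) (U : IM m) : Set where
          field
            R N : IM m
            reach : Reach k R
            factor : R ∙ N ≋ M mod 2^ k
            symplectic : SymplecticMod (2^ k) N
            expansion : Expansion n N U

        advance : ∀ {n U} → Stage (suc n) U → (mv : Move (suc n)) → Stage (suc n) (λ a b → Move.W mv a b + U a b)
        advance {n} {U} st mv = record
          { R = R ∙ c
          ; N = Q ∙ N
          ; reach = reach-commutator R reach A A′ B B′ A∈H A′∈H B∈H B′∈H A-inverse B-inverse
          ; factor = ≋-trans (≈⇒≋ (≈-trans (∙-assoc R c (Q ∙ N)) (∙-cong (≈-refl {A = R}) (cancel-inverse c Q N inverts)))) factor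
          ; symplectic = ≋-trans (≈⇒≋ (form-invariant Q Q-symplectic N)) symplectic
          ; expansion = expansion-∙ n Q N W U Q-expansion expansion
          }
          where
          open Stage st
          open Move mv
          c : IM m
          c = A ∙ (B ∙ (A′ ∙ B′))

        Pair : Set
        Pair = Fin m × Fin m

        record Sweep (n : ℕ) (L : List Pair) : Set where
          field
            U : IM m
            stage : Stage n U
            cleared : ∀ i j → (i , j) ∈ L → + 2 ∣ U (partner i) j

        stays-even : ∀ {w u} → w ≡ + 0 ⊎ + 2 ∣ w + u → + 2 ∣ u → + 2 ∣ w + u
        stays-even {u = u} (inj₁ refl) 2∣u = subst (+ 2 ∣_) (sym (ℤP.+-identityˡ u)) 2∣u
        stays-even (inj₂ 2∣w+u) _ = 2∣w+u

        sweep-step : ∀ t {L} → suc (suc (suc t)) ≤ k → Sweep (suc (suc t)) L → ∀ i j → Sweep (suc (suc t)) ((i , j) ∷ L)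
        sweep-step t {L} n<k sw i j = record
          { U = λ a b → Move.W move a b + U a b
          ; stage = advance stage move
          ; cleared = cleared′ }
          where
          open Sweep sw
          symmetric : SymmetricMod2 U
          symmetric = expansion-symmetric (suc t) (Stage.N stage) U (Stage.expansion stage)
                        (≋-weaken (2^-mono n<k) (Stage.symplectic stage))
          open Clearing (clearing t U symmetric i j)
          cleared′ : ∀ i′ j′ → (i′ , j′) ∈ (i , j) ∷ L → + 2 ∣ Move.W move (partner i′) j′ + U (partner i′) j′
          cleared′ i′ j′ (here refl) = clears
          cleared′ i′ j′ (there ∈L) = stays-even (settles (partner i′) j′) (cleared i′ j′ ∈L)

        sweep : ∀ t → suc (suc (suc t)) ≤ k → ∀ U → Stage (suc (suc t)) U → (L : List Pair) → Sweep (suc (suc t)) L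
        sweep t n<k U st [] = record { U = U ; stage = st ; cleared = λ _ _ () }
        sweep t n<k U st ((i , j) ∷ L) = sweep-step t n<k (sweep t n<k U st L) i j

        record Approximation (n : ℕ) : Set where
          field
            R N : IM m
            reach : Reach k R
            factor : R ∙ N ≋ M mod 2^ k
            symplectic : SymplecticMod (2^ k) N
            near-identity : N ≋ δ mod 2^ n

        level-step : ∀ t → suc (suc (suc t)) ≤ k → Approximation (suc (suc t)) → Approximation (suc (suc (suc t)))
        level-step t n<k ap = record
          { R = Stage.R final ; N = Stage.N final ; reach = Stage.reach final
          ; factor = Stage.factor final ; symplectic = Stage.symplectic final
          ; near-identity = expansion-done (suc (suc t)) (Stage.N final) (Sweep.U swept) (Stage.expansion final) all-even }
          where
          open Approximation ap
          first-order : Σ (IM m) (Expansion (suc (suc t)) N)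
          first-order = expansion-intro (suc (suc t)) N near-identity
          swept : Sweep (suc (suc t)) (cartesianProduct (allFin m) (allFin m))
          swept = sweep t n<k (proj₁ first-order)
                    (record { R = R ; N = N ; reach = reach ; factor = factor ; symplectic = symplectic ; expansion = proj₂ first-order })
                    (cartesianProduct (allFin m) (allFin m))
          final : Stage (suc (suc t)) (Sweep.U swept)
          final = Sweep.stage swept
          all-even : ∀ a b → + 2 ∣ Sweep.U swept a b
          all-even a b = subst (λ a′ → + 2 ∣ Sweep.U swept a′ b) (partner-involutive a)
            (Sweep.cleared swept (partner a) b (∈-cartesianProduct⁺ (∈-allFin (partner a)) (∈-allFin b)))

        climb : ∀ d t → d ℕ.+ suc (suc t) ≡ k → Approximation (suc (suc t)) → Approximation k
        climb zero t refl ap = ap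
        climb (suc d) t d+n≡k ap = climb d (suc t) d+n′≡k (level-step t (subst (suc (suc (suc t)) ≤_) d+n′≡k (ℕP.m≤n+m _ d)) ap)
          where
          d+n′≡k : d ℕ.+ suc (suc (suc t)) ≡ k
          d+n′≡k = trans (ℕP.+-suc d (suc (suc t))) d+n≡k

        -- At level k the error N is invisible modulo 2ᵏ.
        finish : Approximation k → Reach k M
        finish ap = reach-≋ reach (≋-trans (≈⇒≋ (≈-sym (∙-identityʳ R))) (≋-trans (∙-≋ (≋-refl {A = R}) (≋-sym near-identity)) factor))
          where open Approximation ap

  kernel⊆closure : ∀ g (H : Mat (2 ℕ.* g) → Set) → IsSubgroupGSp g H → FullPreimage g H →
    ∀ M → IsSp g M → CongMat 2 M idM → InClosureComm H M
  kernel⊆closure g H H-subgroup H-full M M-Sp@(M-coherent , _) M≡I =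
    reach⇒closure M (λ k → reach k (ℕP.≤-total 2 k))
    where
    open Symplectic g
    open Commutators H H-subgroup H-full
    -- Below level 2, M is already ≡ I; above it, eliminate starting from R = I, N = M.
    reach : ∀ k → 2 ≤ k ⊎ k ≤ 2 → Reach k (level k M)
    reach k (inj₂ k≤2) = reach-≋ (reach-δ k) (≋-sym (level-near-identity M M-coherent M≡I ℕP.≤-refl k≤2))
    reach k (inj₁ 2≤k) = finish (climb (k ∸ 2) 0 (ℕP.m∸n+n≡m 2≤k) start)
      where
      open Elimination k (level k M)
      start : Approximation 2
      start = record
        { R = δ ; N = level k M ; reach = reach-δ k ; factor = ≈⇒≋ (∙-identityˡ (level k M))
        ; symplectic = IsSp⇒SymplecticMod M M-Sp k ; near-identity = level-near-identity M M-coherent M≡I 2≤k ℕP.≤-refl }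

open import Data.Nat using (ℕ; _≤_; _*_)

-- Corollary 2.5.
corollary2p5 : (g : ℕ) → 2 ≤ g → (H : Mat (2 * g) → Set) →
  IsSubgroupGSp g H → FullPreimage g H → ContainsS g H →
  ∀ M → IsSp g M → CongMat 2 M idM → InClosureComm H M
corollary2p5 g _ H H-subgroup H-full _ = Development.kernel⊆closure g H H-subgroup H-full
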